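{- A set $\mathcal C\subseteq\mathcal P^{\circ\bullet}$ of two-colored partitions is a category of two-colored partitions if and only if (i) $\mathcal C$ contains the partition with exactly one lower point and one upper point, both white, forming a single block, and (ii) $\mathcal C$ is closed under tensor products, the four basic rotations, verticolor reflection and erasing turns.
   Context: A two-colored partition $p$ consists of two disjoint, possibly empty, finite totally ordered sets $R_L$ (lower row) and $R_U$ (upper row), a decomposition of the set of points $P_p=R_L\cup R_U$ into disjoint nonempty blocks, and a coloring assigning each point $\circ$ (white) or $\bullet$ (black); $\mathcal P^{\circ\bullet}$ is the set of all two-colored partitions and $\emptyset$ the one with both rows empty. Orientation: the cyclic order on $P_p$ agreeing with the order of $R_L$ on $R_L$, with the reverse order of $R_U$ on $R_U$, such that the maximum of $R_U$ succeeds the maximum of $R_L$ and the minimum of $R_L$ succeeds the minimum of $R_U$. Normalized color: the color for lower points, the inverse color for upper points; $\sigma_p(S)$ = (number of normalized-white points in $S$) minus (number of normalized-black points in $S$). Operations: The tensor product $p\otimes p'$ appends the rows of $p'$ to the right of the respective rows of $p$ (blocks and colors kept). The involution $p^*$ exchanges the roles of upper and lower row. A pair $(p,p')$ is composable if the upper row of $p$ and the lower row of $p'$ have equal length and the same colors rank by rank; then the composition $pp'$ has the lower row of $p$ as lower row and the upper row of $p'$ as upper row, and, after identifying the upper row of $p$ with the lower row of $p'$ rank by rank, its blocks are the nonempty intersections with (lower row of $p$) $\cup$ (upper row of $p'$) of the classes of the equivalence relation generated by "lying in a common block of $p$ or in a common block of $p'$". The four basic rotations: remove the leftmost (resp. rightmost)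 upper point $\alpha$ and add a new leftmost (resp. rightmost) lower point of the inverse color of $\alpha$ taking the place of $\alpha$ in its block; or, conversely, remove the leftmost (resp. rightmost) lower point and add a new leftmost (resp. rightmost) upper point of inverse color taking its place in its block. The verticolor reflection $\tilde p$ reverses the orders of both rows and inverts all colors. A turn is a set $\{\alpha,\beta\}$ of two points with $\beta$ the successor of $\alpha$ in the cyclic order and $\sigma_p(\{\alpha,\beta\})=0$. Erasing a set $S$ of points gives the partition $E(p,S)$ obtained by removing the points of $S$ and merging all remaining points whose blocks met $S$ into a single block (other blocks unchanged). A category of two-colored partitions is a set $\mathcal C\subseteq\mathcal P^{\circ\bullet}$ containing $\emptyset$, the two partitions with one lower and one upper point of the same color ($\circ$ or $\bullet$) forming one block, and the two partitions without upper points and with two lower points colored $\bullet\circ$ resp. $\circ\bullet$ forming one block, and which is closed under tensor products, involution and composition of composable pairs. -}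

module Defs where

open import Level using (0ℓ)
open import Data.Nat using (ℕ; zero; suc; _+_; _∸_)
open import Data.Fin using (Fin; zero; suc; toℕ; fromℕ; inject₁; splitAt; opposite; punchIn; punchOut)
open import Data.Vec using (Vec; []; _∷_; lookup; removeAt; _∷ʳ_; _++_; reverse; map)
open import Data.Sum using (_⊎_; inj₁; inj₂)
open import Data.Sum.Relation.Binary.Pointwise using (Pointwise)
open import Data.Product using (_×_; _,_; proj₁; proj₂)
open import Data.Unit using (⊤; tt)
open import Data.Empty using (⊥)
open import Relation.Binary using (Rel)
open import Relation.Binary.Construct.Closure.Equivalence using (EqClosure)
open import Relation.Binary.PropositionalEquality using (_≡_; _≢_; refl; cong)

data Col : Set where
  white black : Col

inv : Col → Col
inv white = black
inv black = white

-- Points of a partition with k lower and l upper points: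
-- inj₁ i = i-th lower point, inj₂ j = j-th upper point
-- (index 0 = leftmost point of the row).

Pt : ℕ → ℕ → Set
Pt k l = Fin k ⊎ Fin l

-- A (representation of a) two-coloured partition: the rows with their
-- colours and a relation R on the points; the blocks are the classes of
-- the equivalence relation generated by R (so every partition has
-- representatives, and two representatives denote the same partition
-- iff they are ≈-related, see below).
record Part : Set₁ where
  constructor mk
  field
    {k} : ℕ
    {l} : ℕ
    lo  : Vec Col k
    up  : Vec Col l
    R   : Rel (Pt k l) 0ℓ

open Part public

Cl : ∀ {A : Set} → Rel A 0ℓ → Rel A 0ℓ
Cl R = EqClosure R

data _≈_ : Part → Part → Set₁ where
  same : ∀ {k l} {lo : Vec Col k} {up : Vec Col l} {R R′ : Rel (Pt k l) 0ℓ} →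
         (∀ x y → (Cl R x y → Cl R′ x y) × (Cl R′ x y → Cl R x y)) →
         mk lo up R ≈ mk lo up R′

-- A subset C of P°• is given by a predicate on representations which
-- does not depend on the chosen representation.
IsSetOfPartitions : (Part → Set) → Set₁
IsSetOfPartitions C = ∀ {p q} → p ≈ q → C p → C q

∅ : Part
∅ = mk [] [] (λ _ _ → ⊥)

idP : Col → Part
idP c = mk (c ∷ []) (c ∷ []) (λ _ _ → ⊤)

pairP : Col → Col → Part
pairP c c′ = mk (c ∷ c′ ∷ []) [] (λ _ _ → ⊤)

side : ∀ {k k′ l l′} → Pt (k + k′) (l + l′) → Pt k l ⊎ Pt k′ l′
side {k} {k′} {l} {l′} (inj₁ i) with splitAt k {k′} i
... | inj₁ a = inj₁ (inj₁ a)
... | inj₂ b = inj₂ (inj₁ b)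
side {k} {k′} {l} {l′} (inj₂ j) with splitAt l {l′} j
... | inj₁ a = inj₁ (inj₂ a)
... | inj₂ b = inj₂ (inj₂ b)

_⊗_ : Part → Part → Part
p ⊗ q = mk (lo p ++ lo q) (up p ++ up q)
           (λ x y → Pointwise (R p) (R q) (side {k p} {k q} {l p} {l q} x)
                                           (side {k p} {k q} {l p} {l q} y))

swapPt : ∀ {k l} → Pt l k → Pt k l
swapPt (inj₁ i) = inj₂ i
swapPt (inj₂ j) = inj₁ j

_* : Part → Part
p * = mk (up p) (lo p) (λ x y → R p (swapPt x) (swapPt y))

-- Composition of the composable pair (mk lo mid R , mk mid up R′):
-- points are identified via the shared middle row.

data MPt (k m l : ℕ) : Set where
  low  : Fin k → MPt k m l
  mid  : Fin m → MPt k m l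
  high : Fin l → MPt k m l

embL : ∀ {k m l} → Pt k m → MPt k m l
embL (inj₁ i) = low i
embL (inj₂ j) = mid j

embU : ∀ {k m l} → Pt m l → MPt k m l
embU (inj₁ j) = mid j
embU (inj₂ u) = high u

data Union {k m l} (R : Rel (Pt k m) 0ℓ) (R′ : Rel (Pt m l) 0ℓ) :
           Rel (MPt k m l) 0ℓ where
  fromL : ∀ x y → R x y  → Union R R′ (embL x) (embL y)
  fromU : ∀ x y → R′ x y → Union R R′ (embU x) (embU y)

outer : ∀ {k m l} → Pt k l → MPt k m l
outer (inj₁ i) = low i
outer (inj₂ u) = high u

compose : ∀ {k m l} → Vec Col k → Vec Col m → Vec Col l →
          Rel (Pt k m) 0ℓ → Rel (Pt m l) 0ℓ → Part
compose {k} {m} {l} lo mi u R R′ =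
  mk lo u (λ x y → Cl (Union R R′) (outer {k} {m} {l} x) (outer y))

-- The four basic rotations (stated on components; `rel f R` transports
-- the blocks along the bijection f from new points to old points).

rel : ∀ {A B : Set} → (A → B) → Rel B 0ℓ → Rel A 0ℓ
rel f R x y = R (f x) (f y)

snocView : ∀ {n} → Fin (suc n) → Fin n ⊎ ⊤
snocView {zero}  zero    = inj₂ tt
snocView {suc n} zero    = inj₁ zero
snocView {suc n} (suc i) with snocView {n} i
... | inj₁ a  = inj₁ (suc a)
... | inj₂ tt = inj₂ tt

rotUL : ∀ {k l} → Vec Col k → Col → Vec Col l → Rel (Pt k (suc l)) 0ℓ → Part
rotUL {k} {l} lo c u R = mk (inv c ∷ lo) u (rel f R)
  where
  f : Pt (suc k) l → Pt k (suc l)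
  f (inj₁ zero)    = inj₂ zero
  f (inj₁ (suc i)) = inj₁ i
  f (inj₂ j)       = inj₂ (suc j)

rotUR : ∀ {k l} → Vec Col k → Vec Col l → Col → Rel (Pt k (suc l)) 0ℓ → Part
rotUR {k} {l} lo u c R = mk (lo ∷ʳ inv c) u (rel f R)
  where
  f : Pt (suc k) l → Pt k (suc l)
  f (inj₁ i) with snocView {k} i
  ... | inj₁ a  = inj₁ a
  ... | inj₂ tt = inj₂ (fromℕ l)
  f (inj₂ j) = inj₂ (inject₁ j)

rotLL : ∀ {k l} → Col → Vec Col k → Vec Col l → Rel (Pt (suc k) l) 0ℓ → Part
rotLL {k} {l} c lo u R = mk lo (inv c ∷ u) (rel f R)
  where
  f : Pt k (suc l) → Pt (suc k) l
  f (inj₁ i)       = inj₁ (suc i)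
  f (inj₂ zero)    = inj₁ zero
  f (inj₂ (suc j)) = inj₂ j

rotLR : ∀ {k l} → Vec Col k → Col → Vec Col l → Rel (Pt (suc k) l) 0ℓ → Part
rotLR {k} {l} lo c u R = mk lo (u ∷ʳ inv c) (rel f R)
  where
  f : Pt k (suc l) → Pt (suc k) l
  f (inj₁ i) = inj₁ (inject₁ i)
  f (inj₂ j) with snocView {l} j
  ... | inj₁ a  = inj₂ a
  ... | inj₂ tt = inj₁ (fromℕ k)

oppPt : ∀ {k l} → Pt k l → Pt k l
oppPt (inj₁ i) = inj₁ (opposite i)
oppPt (inj₂ j) = inj₂ (opposite j)

vreflect : Part → Part
vreflect p = mk (reverse (map inv (lo p))) (reverse (map inv (up p)))
                (rel oppPt (R p))

-- position in the cyclic order: L0,…,L(k-1),U(l-1),…,U0 (then back to L0)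
pos : ∀ {k l} → Pt k l → ℕ
pos (inj₁ i) = toℕ i
pos {k} {l} (inj₂ j) = k + (l ∸ suc (toℕ j))

Succ : (p : Part) → Pt (k p) (l p) → Pt (k p) (l p) → Set
Succ p x y = (suc (pos x) ≡ pos y) ⊎ (suc (pos x) ≡ k p + l p × pos y ≡ 0)

ncol : (p : Part) → Pt (k p) (l p) → Col
ncol p (inj₁ i) = lookup (lo p) i
ncol p (inj₂ j) = inv (lookup (up p) j)

-- {α,β} is a turn of p: two distinct points, β the successor of α,
-- σ_p({α,β}) = 0 (i.e. their normalized colours differ)
Turn : (p : Part) → Pt (k p) (l p) → Pt (k p) (l p) → Set
Turn p α β = Succ p α β × α ≢ β × ncol p α ≢ ncol p β

merge : (p : Part) → Pt (k p) (l p) → Pt (k p) (l p) → Part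
merge p α β = mk (lo p) (up p)
  (λ x y → R p x y ⊎ ((Cl (R p) x α ⊎ Cl (R p) x β) × (Cl (R p) y α ⊎ Cl (R p) y β)))

deleteLo : ∀ {k l} → Vec Col k → Vec Col l → Rel (Pt k l) 0ℓ → Fin k → Part
deleteLo {suc k} {l} lo u R i = mk (removeAt lo i) u (rel e (Cl R))
  where
  e : Pt k l → Pt (suc k) l
  e (inj₁ a) = inj₁ (punchIn i a)
  e (inj₂ b) = inj₂ b

deleteUp : ∀ {k l} → Vec Col k → Vec Col l → Rel (Pt k l) 0ℓ → Fin l → Part
deleteUp {k} {suc l} lo u R j = mk lo (removeAt u j) (rel e (Cl R))
  where
  e : Pt k l → Pt k (suc l)
  e (inj₁ a) = inj₁ a
  e (inj₂ b) = inj₂ (punchIn j b)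

deleteC : ∀ {k l} → Vec Col k → Vec Col l → Rel (Pt k l) 0ℓ → Pt k l → Part
deleteC lo u R (inj₁ i) = deleteLo lo u R i
deleteC lo u R (inj₂ j) = deleteUp lo u R j

delete : (p : Part) → Pt (k p) (l p) → Part
delete p α = deleteC (lo p) (up p) (R p) α

shiftC : ∀ {k l} (lo : Vec Col k) (u : Vec Col l) (R : Rel (Pt k l) 0ℓ)
         (α β : Pt k l) → α ≢ β → Pt (Part.k (deleteC lo u R α)) (Part.l (deleteC lo u R α))
shiftC {suc k} lo u R (inj₁ i) (inj₁ j) ne = inj₁ (punchOut {i = i} {j = j} (λ e → ne (cong inj₁ e)))
shiftC {suc k} lo u R (inj₁ i) (inj₂ j) ne = inj₂ j
shiftC {k} {suc l} lo u R (inj₂ i) (inj₁ j) ne = inj₁ j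
shiftC {k} {suc l} lo u R (inj₂ i) (inj₂ j) ne = inj₂ (punchOut {i = i} {j = j} (λ e → ne (cong inj₂ e)))

erase : (p : Part) (α β : Pt (k p) (l p)) → α ≢ β → Part
erase p α β ne = delete (delete p′ α) (shiftC (lo p′) (up p′) (R p′) α β ne)
  where p′ = merge p α β

ClosedTensor : (Part → Set) → Set₁
ClosedTensor C = ∀ p q → C p → C q → C (p ⊗ q)

ClosedInvolution : (Part → Set) → Set₁
ClosedInvolution C = ∀ p → C p → C (p *)

ClosedComposition : (Part → Set) → Set₁
ClosedComposition C =
  ∀ {k m l} (lo : Vec Col k) (mi : Vec Col m) (u : Vec Col l) R R′ →
  C (mk lo mi R) → C (mk mi u R′) → C (compose lo mi u R R′)

IsCategory : (Part → Set) → Set₁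
IsCategory C =
  C ∅ × C (idP white) × C (idP black) × C (pairP black white) × C (pairP white black) ×
  ClosedTensor C × ClosedInvolution C × ClosedComposition C

ClosedRotations : (Part → Set) → Set₁
ClosedRotations C =
  (∀ {k l} (lo : Vec Col k) c (u : Vec Col l) R → C (mk lo (c ∷ u) R) → C (rotUL lo c u R)) ×
  (∀ {k l} (lo : Vec Col k) (u : Vec Col l) c R → C (mk lo (u ∷ʳ c) R) → C (rotUR lo u c R)) ×
  (∀ {k l} c (lo : Vec Col k) (u : Vec Col l) R → C (mk (c ∷ lo) u R) → C (rotLL c lo u R)) ×
  (∀ {k l} (lo : Vec Col k) c (u : Vec Col l) R → C (mk (lo ∷ʳ c) u R) → C (rotLR lo c u R))

ClosedVerticolor : (Part → Set) → Set₁
ClosedVerticolor C = ∀ p → C p → C (vreflect p)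

ClosedErasingTurns : (Part → Set) → Set₁
ClosedErasingTurns C =
  ∀ p α β → (t : Turn p α β) → C p → C (erase p α β (proj₁ (proj₂ t)))

-- The four rotations act on the cyclic order of the points: rotUR and rotLR keep every
-- point at its position and rotLL advances all positions by one, so a set closed under
-- rotations is closed under every cyclic relabelling of a partition.  The involution p *
-- is such a relabelling of the verticolor reflection of p, which makes the two
-- interchangeable.  In a category, rotations are compositions with pair and identity
-- partitions, and a turn is erased by rotating it onto the first two lower points and
-- composing with (pairP c c′)* ⊗ id.  Conversely, a composition along a middle row of
-- length m + 1 is obtained by rotating the first middle point out of both factors,
-- composing along the remaining m points and erasing the turn formed by the two rotated
-- copies; along an empty middle row, composition is a tensor product.

module Submission where

open import Defs
open import Level using (0ℓ)
open import Function.Base using (id; _∘_)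
open import Function.Bundles using (_⇔_; mk⇔; Equivalence)
open import Function.Construct.Composition using (_⇔-∘_)
open import Function.Construct.Symmetry using (⇔-sym)
open import Function.Construct.Identity using (⇔-id)
open import Function.Properties.Equivalence using (⇔-setoid)
open import Data.Nat using (ℕ; zero; suc; >-nonZero⁻¹; ≢-nonZero⁻¹; _+_; _∸_; _<_; _≤_; _<?_; z≤n; s≤s; z<s; NonZero)
open import Data.Nat.Properties
open import Data.Nat.DivMod using (_%_; [m+n]%n≡m%n; %-distribˡ-+; m%n%n≡m%n; m%n<n; m<n⇒m%n≡m; n%n≡0)
open import Data.Fin using (Fin; zero; suc; toℕ; fromℕ; fromℕ<; inject₁; opposite; punchIn; _↑ˡ_; _↑ʳ_; splitAt; cast)
open import Data.Vec using (Vec; []; _∷_; _∷ʳ_; _++_; lookup; tabulate; initLast; reverse; map; removeAt)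
open import Data.Vec.Properties
  using (tabulate∘lookup; lookup∘tabulate; tabulate-cong; reverse-∷; lookup-map; lookup-++ˡ; lookup-cast; unfold-∷ʳ-eqFree)
open import Data.Fin.Properties
  using (toℕ-injective; toℕ<n; toℕ-fromℕ; toℕ-fromℕ<; toℕ-inject₁; toℕ-↑ˡ; toℕ-↑ʳ; toℕ-cast; opposite-prop; opposite-involutive;
         punchIn-punchOut; splitAt-↑ˡ; splitAt-↑ʳ; splitAt⁻¹-↑ˡ; splitAt⁻¹-↑ʳ)
open import Data.Product using (_×_; _,_; proj₁; proj₂)
open import Data.Sum using (_⊎_; inj₁; inj₂)
import Data.Sum as Sum
open import Data.Sum.Relation.Binary.Pointwise using (Pointwise)
import Data.Sum.Relation.Binary.Pointwise as PW
import Data.Product as Product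
open import Data.Unit using (⊤; tt)
open import Data.Empty using (⊥; ⊥-elim)
open import Relation.Nullary using (yes; no)
open import Relation.Binary using (Rel; IsEquivalence)
open import Relation.Binary.PropositionalEquality
  using (_≡_; _≢_; refl; sym; trans; cong; cong₂; subst; subst₂; module ≡-Reasoning)
import Relation.Binary.Construct.Closure.Equivalence as EqClosure
import Relation.Binary.Reasoning.Setoid as SetoidReasoning

module ⇔-Reasoning = SetoidReasoning (⇔-setoid 0ℓ)
open Equivalence using (to; from)

private variable
  A B : Set
  Q S : Rel A 0ℓ

Cl-refl : ∀ {x} → Cl Q x x
Cl-refl {Q = Q} = EqClosure.reflexive Q

Cl-sym : ∀ {x y} → Cl Q x y → Cl Q y x
Cl-sym {Q = Q} = EqClosure.symmetric Q

Cl-trans : ∀ {x y z} → Cl Q x y → Cl Q y z → Cl Q x z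
Cl-trans {Q = Q} = EqClosure.transitive Q

Cl-reflexive : ∀ {x y} → x ≡ y → Cl Q x y
Cl-reflexive refl = Cl-refl

Cl-gbind : (f : A → B) → (∀ {x y} → Q x y → Cl S (f x) (f y)) →
           ∀ {x y} → Cl Q x y → Cl S (f x) (f y)
Cl-gbind {S = S} = EqClosure.gfold (EqClosure.isEquivalence S)

Cl-⇔-quasiInverse : (f : A → B) (g : B → A) →
  (∀ {x y} → Q x y → Cl S (f x) (f y)) → (∀ {x y} → S x y → Cl Q (g x) (g y)) →
  (∀ x → Cl Q x (g (f x))) → ∀ x y → Cl Q x y ⇔ Cl S (f x) (f y)
Cl-⇔-quasiInverse f g f-resp g-resp gf x y = mk⇔ (Cl-gbind f f-resp)
  λ s → Cl-trans (gf x) (Cl-trans (Cl-gbind g g-resp s) (Cl-sym (gf y)))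

Cl-rel-bijection : (f : A → B) (g : B → A) → (∀ x → g (f x) ≡ x) → (∀ y → f (g y) ≡ y) →
  ∀ x y → Cl (rel f Q) x y ⇔ Cl Q (f x) (f y)
Cl-rel-bijection {Q = Q} f g gf fg = Cl-⇔-quasiInverse f g EqClosure.return
  (λ {x} {y} r → EqClosure.return (subst₂ Q (sym (fg x)) (sym (fg y)) r))
  (λ x → subst (Cl (rel f Q) x) (sym (gf x)) Cl-refl)

Cl-rel-Cl : (f : A → B) → ∀ x y → Cl (rel f (Cl Q)) x y ⇔ Cl Q (f x) (f y)
Cl-rel-Cl f x y = mk⇔ (Cl-gbind f id) EqClosure.return

Cl-cong : (∀ x y → Q x y ⇔ S x y) → ∀ x y → Cl Q x y ⇔ Cl S x y
Cl-cong Q⇔S x y = mk⇔ (EqClosure.map (to (Q⇔S _ _))) (EqClosure.map (from (Q⇔S _ _)))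


module Merge (Q : Rel A 0ℓ) (α β : A) where

  Touches : A → Set
  Touches z = Cl Q z α ⊎ Cl Q z β

  Merged : Rel A 0ℓ
  Merged a b = Cl Q a b ⊎ (Touches a × Touches b)

  touches-resp : ∀ {a b} → Cl Q a b → Touches b → Touches a
  touches-resp p (inj₁ q) = inj₁ (Cl-trans p q)
  touches-resp p (inj₂ q) = inj₂ (Cl-trans p q)

  Merged-isEquivalence : IsEquivalence Merged
  Merged-isEquivalence = record { refl = inj₁ Cl-refl ; sym = symm ; trans = tran }
    where
    symm : ∀ {a b} → Merged a b → Merged b a
    symm (inj₁ p) = inj₁ (Cl-sym p)
    symm (inj₂ (ta , tb)) = inj₂ (tb , ta)
    tran : ∀ {a b c} → Merged a b → Merged b c → Merged a c
    tran (inj₁ p) (inj₁ q) = inj₁ (Cl-trans p q)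
    tran (inj₁ p) (inj₂ (tb , tc)) = inj₂ (touches-resp p tb , tc)
    tran (inj₂ (ta , tb)) (inj₁ q) = inj₂ (ta , touches-resp (Cl-sym q) tb)
    tran (inj₂ (ta , _)) (inj₂ (_ , tc)) = inj₂ (ta , tc)

  Cl-merge : ∀ a b → Cl (λ x y → Q x y ⊎ (Touches x × Touches y)) a b ⇔ Merged a b
  Cl-merge a b = mk⇔ (EqClosure.fold Merged-isEquivalence step) back
    where
    step : ∀ {x y} → Q x y ⊎ (Touches x × Touches y) → Merged x y
    step (inj₁ r) = inj₁ (EqClosure.return r)
    step (inj₂ t) = inj₂ t
    back : Merged a b → Cl _ a b
    back (inj₁ p) = EqClosure.map inj₁ p
    back (inj₂ t) = EqClosure.return (inj₂ t)

  data WithEdge : Rel A 0ℓ where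
    old : ∀ {a b} → Q a b → WithEdge a b
    new : WithEdge α β

  Cl-WithEdge : ∀ a b → Cl WithEdge a b ⇔ Merged a b
  Cl-WithEdge a b = mk⇔ (EqClosure.fold Merged-isEquivalence step) back
    where
    step : ∀ {x y} → WithEdge x y → Merged x y
    step (old r) = inj₁ (EqClosure.return r)
    step new = inj₂ (inj₁ Cl-refl , inj₂ Cl-refl)
    toβ : ∀ {z} → Touches z → Cl WithEdge z β
    toβ (inj₁ q) = Cl-trans (EqClosure.map old q) (EqClosure.return new)
    toβ (inj₂ q) = EqClosure.map old q
    back : Merged a b → Cl WithEdge a b
    back (inj₁ p) = EqClosure.map old p
    back (inj₂ (ta , tb)) = Cl-trans (toβ ta) (Cl-sym (toβ tb))
Merged-transport : (f : A → B) → (∀ x y → Cl Q x y ⇔ Cl S (f x) (f y)) → (α β : A) → ∀ a b →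
  Merge.Merged Q α β a b ⇔ Merge.Merged S (f α) (f β) (f a) (f b)
Merged-transport {Q = Q} {S = S} f Q⇔S α β a b =
  mk⇔ (Sum.map (to (Q⇔S a b)) (Product.map (touches a) (touches b)))
      (Sum.map (from (Q⇔S a b)) (Product.map (touches⁻¹ a) (touches⁻¹ b)))
  where
  touches : ∀ z → Merge.Touches Q α β z → Merge.Touches S (f α) (f β) (f z)
  touches z = Sum.map (to (Q⇔S z α)) (to (Q⇔S z β))
  touches⁻¹ : ∀ z → Merge.Touches S (f α) (f β) (f z) → Merge.Touches Q α β z
  touches⁻¹ z = Sum.map (from (Q⇔S z α)) (from (Q⇔S z β))

pos-upper : ∀ {k l} (j : Fin l) → pos {k} (inj₂ j) ≡ k + toℕ (opposite j)
pos-upper {k} j = cong (k +_) (sym (opposite-prop j))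

pos-< : ∀ {k l} (x : Pt k l) → pos x < k + l
pos-< {k} {l} (inj₁ i) = <-≤-trans (toℕ<n i) (m≤m+n k l)
pos-< {k} {l} (inj₂ j) = subst (_< k + l) (sym (pos-upper j)) (+-monoʳ-< k (toℕ<n (opposite j)))

lower-<-upper : ∀ {k l} (i : Fin k) (j : Fin l) → pos {k} {l} (inj₁ i) < pos {k} {l} (inj₂ j)
lower-<-upper {k} i j = <-≤-trans (toℕ<n i) (m≤m+n k _)

pos-injective : ∀ {k l} {x y : Pt k l} → pos x ≡ pos y → x ≡ y
pos-injective {x = inj₁ i} {inj₁ j} e = cong inj₁ (toℕ-injective e)
pos-injective {x = inj₁ i} {inj₂ j} e = ⊥-elim (<⇒≢ (lower-<-upper i j) e)
pos-injective {x = inj₂ i} {inj₁ j} e = ⊥-elim (<⇒≢ (lower-<-upper j i) (sym e))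
pos-injective {k} {x = inj₂ i} {inj₂ j} e = cong inj₂ (begin
  i                       ≡⟨ opposite-involutive i ⟨
  opposite (opposite i)   ≡⟨ cong opposite (toℕ-injective (+-cancelˡ-≡ k _ _ opp-i≡opp-j)) ⟩
  opposite (opposite j)   ≡⟨ opposite-involutive j ⟩
  j                       ∎)
  where
  open ≡-Reasoning
  opp-i≡opp-j : k + toℕ (opposite i) ≡ k + toℕ (opposite j)
  opp-i≡opp-j = trans (sym (pos-upper i)) (trans e (pos-upper j))

m<k+l⇒m∸k<l : ∀ {k l m} → m < k + l → k ≤ m → m ∸ k < l
m<k+l⇒m∸k<l {k} {l} m<k+l k≤m = +-cancelˡ-< k _ _ (subst (_< k + l) (sym (m+[n∸m]≡n k≤m)) m<k+l)

pointAt : ∀ {k l} m → m < k + l → Pt k l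
pointAt {k} {l} m m<k+l with m <? k
... | yes m<k = inj₁ (fromℕ< m<k)
... | no m≮k = inj₂ (opposite (fromℕ< (m<k+l⇒m∸k<l m<k+l (≮⇒≥ m≮k))))

pos-pointAt : ∀ {k l} m (m<k+l : m < k + l) → pos (pointAt {k} {l} m m<k+l) ≡ m
pos-pointAt {k} {l} m m<k+l with m <? k
... | yes m<k = toℕ-fromℕ< m<k
... | no m≮k = begin
  pos {k} {l} (inj₂ (opposite j))   ≡⟨ pos-upper (opposite j) ⟩
  k + toℕ (opposite (opposite j))   ≡⟨ cong (λ i → k + toℕ i) (opposite-involutive j) ⟩
  k + toℕ j                         ≡⟨ cong (k +_) (toℕ-fromℕ< _) ⟩
  k + (m ∸ k)                       ≡⟨ m+[n∸m]≡n (≮⇒≥ m≮k) ⟩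
  m                                 ∎
  where
  open ≡-Reasoning
  j : Fin l
  j = fromℕ< (m<k+l⇒m∸k<l m<k+l (≮⇒≥ m≮k))

module ModularArithmetic (n : ℕ) .{{_ : NonZero n}} where

  [m%n+o]%n≡[m+o]%n : ∀ m o → (m % n + o) % n ≡ (m + o) % n
  [m%n+o]%n≡[m+o]%n m o = begin
    (m % n + o) % n            ≡⟨ %-distribˡ-+ (m % n) o n ⟩
    (m % n % n + o % n) % n    ≡⟨ cong (λ z → (z + o % n) % n) (m%n%n≡m%n m n) ⟩
    (m % n + o % n) % n        ≡⟨ %-distribˡ-+ m o n ⟨
    (m + o) % n                ∎
    where open ≡-Reasoning

  [m+o%n]%n≡[m+o]%n : ∀ m o → (m + o % n) % n ≡ (m + o) % n
  [m+o%n]%n≡[m+o]%n m o = begin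
    (m + o % n) % n   ≡⟨ cong (_% n) (+-comm m (o % n)) ⟩
    (o % n + m) % n   ≡⟨ [m%n+o]%n≡[m+o]%n o m ⟩
    (o + m) % n       ≡⟨ cong (_% n) (+-comm o m) ⟩
    (m + o) % n       ∎
    where open ≡-Reasoning

  negate : ℕ → ℕ
  negate s = n ∸ s % n

  [s+negate[s]]%n≡0 : ∀ s → (s + negate s) % n ≡ 0
  [s+negate[s]]%n≡0 s = begin
    (s + (n ∸ s % n)) % n       ≡⟨ [m%n+o]%n≡[m+o]%n s (n ∸ s % n) ⟨
    (s % n + (n ∸ s % n)) % n   ≡⟨ cong (_% n) (m+[n∸m]≡n (<⇒≤ (m%n<n s n))) ⟩
    n % n                       ≡⟨ n%n≡0 n ⟩
    0                           ∎
    where open ≡-Reasoning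

  o%n≡0⇒[m+o]%n≡m%n : ∀ m o → o % n ≡ 0 → (m + o) % n ≡ m % n
  o%n≡0⇒[m+o]%n≡m%n m o o%n≡0 = begin
    (m + o) % n       ≡⟨ [m+o%n]%n≡[m+o]%n m o ⟨
    (m + o % n) % n   ≡⟨ cong (λ z → (m + z) % n) o%n≡0 ⟩
    (m + 0) % n       ≡⟨ cong (_% n) (+-identityʳ m) ⟩
    m % n             ∎
    where open ≡-Reasoning

  [[m+s]%n+negate[s]]%n≡m : ∀ m s → m < n → ((m + s) % n + negate s) % n ≡ m
  [[m+s]%n+negate[s]]%n≡m m s m<n = begin
    ((m + s) % n + negate s) % n   ≡⟨ [m%n+o]%n≡[m+o]%n (m + s) (negate s) ⟩
    (m + s + negate s) % n         ≡⟨ cong (_% n) (+-assoc m s (negate s)) ⟩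
    (m + (s + negate s)) % n       ≡⟨ o%n≡0⇒[m+o]%n≡m%n m _ ([s+negate[s]]%n≡0 s) ⟩
    m % n                          ≡⟨ m<n⇒m%n≡m m<n ⟩
    m                              ∎
    where open ≡-Reasoning

  [[m+negate[s]]%n+s]%n≡m : ∀ m s → m < n → ((m + negate s) % n + s) % n ≡ m
  [[m+negate[s]]%n+s]%n≡m m s m<n = begin
    ((m + negate s) % n + s) % n   ≡⟨ [m%n+o]%n≡[m+o]%n (m + negate s) s ⟩
    (m + negate s + s) % n         ≡⟨ cong (_% n) (+-assoc m (negate s) s) ⟩
    (m + (negate s + s)) % n       ≡⟨ cong (λ z → (m + z) % n) (+-comm (negate s) s) ⟩
    (m + (s + negate s)) % n       ≡⟨ o%n≡0⇒[m+o]%n≡m%n m _ ([s+negate[s]]%n≡0 s) ⟩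
    m % n                          ≡⟨ m<n⇒m%n≡m m<n ⟩
    m                              ∎
    where open ≡-Reasoning

  [m+1]%n≡1+m : ∀ {m} → suc m < n → (m + 1) % n ≡ suc m
  [m+1]%n≡1+m {m} 1+m<n = trans (cong (_% n) (+-comm m 1)) (m<n⇒m%n≡m 1+m<n)

  [m+1]%n≡0 : ∀ {m} → suc m ≡ n → (m + 1) % n ≡ 0
  [m+1]%n≡0 {m} 1+m≡n = trans (cong (_% n) (trans (+-comm m 1) 1+m≡n)) (n%n≡0 n)

  0%n≡0 : 0 % n ≡ 0
  0%n≡0 = m<n⇒m%n≡m (>-nonZero⁻¹ n)

  [1+s+negate[1]]%n≡s%n : ∀ s → (suc s + negate 1) % n ≡ s % n
  [1+s+negate[1]]%n≡s%n s = trans (cong (_% n) (sym (+-suc s (negate 1))))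
    (o%n≡0⇒[m+o]%n≡m%n s (suc (negate 1)) ([s+negate[s]]%n≡0 1))

  m<n⇒[m+0]%n≡m : ∀ {m} → m < n → (m + 0) % n ≡ m
  m<n⇒[m+0]%n≡m {m} m<n = trans (cong (_% n) (+-identityʳ m)) (m<n⇒m%n≡m m<n)

inv-involutive : ∀ c → inv (inv c) ≡ c
inv-involutive white = refl
inv-involutive black = refl

inv-injective : ∀ {c d} → inv c ≡ inv d → c ≡ d
inv-injective {c} {d} e = trans (sym (inv-involutive c)) (trans (cong inv e) (inv-involutive d))

lookup-extensionality : ∀ {A : Set} {m} (xs ys : Vec A m) → (∀ i → lookup xs i ≡ lookup ys i) → xs ≡ ys
lookup-extensionality xs ys h = trans (sym (tabulate∘lookup xs)) (trans (tabulate-cong h) (tabulate∘lookup ys))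

size : Part → ℕ
size p = k p + l p

Point : Part → Set
Point p = Pt (k p) (l p)

≈-from-Cl⇔ : ∀ {k l} {lo : Vec Col k} {u : Vec Col l} {R R′ : Rel (Pt k l) 0ℓ} →
  (∀ x y → Cl R x y ⇔ Cl R′ x y) → mk lo u R ≈ mk lo u R′
≈-from-Cl⇔ R⇔R′ = same λ x y → to (R⇔R′ x y) , from (R⇔R′ x y)

module _ (C : Part → Set) (C-resp-≈ : IsSetOfPartitions C) where

  relabel : ∀ {t p} → k t ≡ k p → l t ≡ l p → (f : Point t → Point p) → (∀ x → pos (f x) ≡ pos x) →
    (∀ x → ncol t x ≡ ncol p (f x)) → (∀ x y → Cl (R t) x y ⇔ Cl (R p) (f x) (f y)) → C p → C t
  relabel {mk lo′ u′ R′} {mk lo u R} refl refl f pos-f ncol-f blocks-f Cp =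
    same-rows (lookup-extensionality lo′ lo (λ i → trans (ncol-f (inj₁ i)) (cong (ncol p) (f-id (inj₁ i)))))
              (lookup-extensionality u′ u (λ j → inv-injective (trans (ncol-f (inj₂ j)) (cong (ncol p) (f-id (inj₂ j))))))
    where
    p : Part
    p = mk lo u R
    f-id : ∀ x → f x ≡ x
    f-id x = pos-injective (pos-f x)
    same-rows : lo′ ≡ lo → u′ ≡ u → C (mk lo′ u′ R′)
    same-rows refl refl = C-resp-≈ (same λ x y → let e = blocks-f x y in
        (λ r → from e (subst₂ (Cl R) (sym (f-id x)) (sym (f-id y)) r)) ,
        (λ r′ → subst₂ (Cl R) (f-id x) (f-id y) (to e r′))) Cp

snocView-inj₁ : ∀ {m} {i : Fin (suc m)} {a} → snocView i ≡ inj₁ a → inject₁ a ≡ i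
snocView-inj₁ {suc m} {zero} refl = refl
snocView-inj₁ {suc m} {suc i} e with snocView {m} i in eq
snocView-inj₁ {suc m} {suc i} refl | inj₁ b = cong suc (snocView-inj₁ eq)

snocView-inj₂ : ∀ {m} {i : Fin (suc m)} → snocView i ≡ inj₂ tt → fromℕ m ≡ i
snocView-inj₂ {zero} {zero} refl = refl
snocView-inj₂ {suc m} {suc i} e with snocView {m} i in eq
snocView-inj₂ {suc m} {suc i} refl | inj₂ tt = cong suc (snocView-inj₂ eq)

lookup-∷ʳ-inject₁ : ∀ {A : Set} {m} (xs : Vec A m) y (j : Fin m) → lookup (xs ∷ʳ y) (inject₁ j) ≡ lookup xs j
lookup-∷ʳ-inject₁ (x ∷ xs) y zero = refl
lookup-∷ʳ-inject₁ (x ∷ xs) y (suc j) = lookup-∷ʳ-inject₁ xs y j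

lookup-∷ʳ-fromℕ : ∀ {A : Set} {m} (xs : Vec A m) y → lookup (xs ∷ʳ y) (fromℕ m) ≡ y
lookup-∷ʳ-fromℕ [] y = refl
lookup-∷ʳ-fromℕ (x ∷ xs) y = lookup-∷ʳ-fromℕ xs y

pos-inject₁-upper : ∀ {k l} (j : Fin l) → pos {k} {suc l} (inj₂ (inject₁ j)) ≡ pos {suc k} {l} (inj₂ j)
pos-inject₁-upper {k} {l} j = begin
  k + (l ∸ toℕ (inject₁ j))    ≡⟨ cong (λ i → k + (l ∸ i)) (toℕ-inject₁ j) ⟩
  k + (l ∸ toℕ j)              ≡⟨ cong (k +_) (+-∸-assoc 1 (toℕ<n j)) ⟩
  k + suc (l ∸ suc (toℕ j))    ≡⟨ +-suc k _ ⟩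
  suc k + (l ∸ suc (toℕ j))    ∎
  where open ≡-Reasoning

pos-fromℕ-upper : ∀ {k l} → pos {k} {suc l} (inj₂ (fromℕ l)) ≡ pos {suc k} {l} (inj₁ (fromℕ k))
pos-fromℕ-upper {k} {l} = begin
  k + (l ∸ toℕ (fromℕ l))   ≡⟨ cong (λ i → k + (l ∸ i)) (toℕ-fromℕ l) ⟩
  k + (l ∸ l)               ≡⟨ cong (k +_) (n∸n≡0 l) ⟩
  k + 0                     ≡⟨ +-identityʳ k ⟩
  k                         ≡⟨ toℕ-fromℕ k ⟨
  toℕ (fromℕ k)             ∎
  where open ≡-Reasoning

rotUR-point : ∀ {k l} → Pt (suc k) l → Pt k (suc l)
rotUR-point {k} (inj₁ i) with snocView {k} i
... | inj₁ a  = inj₁ a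
... | inj₂ tt = inj₂ (fromℕ _)
rotUR-point (inj₂ j) = inj₂ (inject₁ j)

pos-rotUR-point : ∀ {k l} (x : Pt (suc k) l) → pos (rotUR-point x) ≡ pos x
pos-rotUR-point {k} {l} (inj₁ i) with snocView {k} i in eq
... | inj₁ a  = trans (sym (toℕ-inject₁ a)) (cong toℕ (snocView-inj₁ eq))
... | inj₂ tt = trans (pos-fromℕ-upper {k} {l}) (cong toℕ (snocView-inj₂ eq))
pos-rotUR-point (inj₂ j) = pos-inject₁-upper j

ncol-rotUR-point : ∀ {k l} (lo : Vec Col k) (u : Vec Col l) c R x →
  ncol (rotUR lo u c R) x ≡ ncol (mk lo (u ∷ʳ c) R) (rotUR-point x)
ncol-rotUR-point {k} lo u c R (inj₁ i) with snocView {k} i in eq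
... | inj₁ a  = trans (cong (lookup (lo ∷ʳ inv c)) (sym (snocView-inj₁ eq))) (lookup-∷ʳ-inject₁ lo (inv c) a)
... | inj₂ tt = begin
  lookup (lo ∷ʳ inv c) i           ≡⟨ cong (lookup (lo ∷ʳ inv c)) (snocView-inj₂ eq) ⟨
  lookup (lo ∷ʳ inv c) (fromℕ k)   ≡⟨ lookup-∷ʳ-fromℕ lo (inv c) ⟩
  inv c                            ≡⟨ cong inv (lookup-∷ʳ-fromℕ u c) ⟨
  inv (lookup (u ∷ʳ c) (fromℕ _))  ∎
  where open ≡-Reasoning
ncol-rotUR-point lo u c R (inj₂ j) = cong inv (sym (lookup-∷ʳ-inject₁ u c j))

R-rotUR : ∀ {k l} (lo : Vec Col k) (u : Vec Col l) c R x y →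
  Part.R (rotUR lo u c R) x y ⇔ R (rotUR-point x) (rotUR-point y)
R-rotUR {k} lo u c R (inj₁ i) (inj₁ j) with snocView {k} i | snocView {k} j
... | inj₁ _ | inj₁ _ = ⇔-id _
... | inj₁ _ | inj₂ _ = ⇔-id _
... | inj₂ _ | inj₁ _ = ⇔-id _
... | inj₂ _ | inj₂ _ = ⇔-id _
R-rotUR {k} lo u c R (inj₁ i) (inj₂ j) with snocView {k} i
... | inj₁ _ = ⇔-id _
... | inj₂ _ = ⇔-id _
R-rotUR {k} lo u c R (inj₂ i) (inj₁ j) with snocView {k} j
... | inj₁ _ = ⇔-id _
... | inj₂ _ = ⇔-id _
R-rotUR lo u c R (inj₂ i) (inj₂ j) = ⇔-id _

rotLR-point : ∀ {k l} → Pt k (suc l) → Pt (suc k) l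
rotLR-point (inj₁ i) = inj₁ (inject₁ i)
rotLR-point {l = l} (inj₂ j) with snocView {l} j
... | inj₁ a  = inj₂ a
... | inj₂ tt = inj₁ (fromℕ _)

pos-rotLR-point : ∀ {k l} (x : Pt k (suc l)) → pos (rotLR-point x) ≡ pos x
pos-rotLR-point (inj₁ i) = toℕ-inject₁ i
pos-rotLR-point {k} {l} (inj₂ j) with snocView {l} j in eq
... | inj₁ a  = trans (sym (pos-inject₁-upper a)) (cong (pos {k} ∘ inj₂) (snocView-inj₁ eq))
... | inj₂ tt = trans (sym (pos-fromℕ-upper {k} {l})) (cong (pos {k} ∘ inj₂) (snocView-inj₂ eq))

ncol-rotLR-point : ∀ {k l} (lo : Vec Col k) c (u : Vec Col l) R x →
  ncol (rotLR lo c u R) x ≡ ncol (mk (lo ∷ʳ c) u R) (rotLR-point x)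
ncol-rotLR-point lo c u R (inj₁ i) = sym (lookup-∷ʳ-inject₁ lo c i)
ncol-rotLR-point {k} {l} lo c u R (inj₂ j) with snocView {l} j in eq
... | inj₁ a  = cong inv (trans (cong (lookup (u ∷ʳ inv c)) (sym (snocView-inj₁ eq))) (lookup-∷ʳ-inject₁ u (inv c) a))
... | inj₂ tt = begin
  inv (lookup (u ∷ʳ inv c) j)          ≡⟨ cong (inv ∘ lookup (u ∷ʳ inv c)) (snocView-inj₂ eq) ⟨
  inv (lookup (u ∷ʳ inv c) (fromℕ l))  ≡⟨ cong inv (lookup-∷ʳ-fromℕ u (inv c)) ⟩
  inv (inv c)                          ≡⟨ inv-involutive c ⟩
  c                                    ≡⟨ lookup-∷ʳ-fromℕ lo c ⟨
  lookup (lo ∷ʳ c) (fromℕ k)           ∎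
  where open ≡-Reasoning

R-rotLR : ∀ {k l} (lo : Vec Col k) c (u : Vec Col l) R x y →
  Part.R (rotLR lo c u R) x y ⇔ R (rotLR-point x) (rotLR-point y)
R-rotLR {l = l} lo c u R (inj₂ i) (inj₂ j) with snocView {l} i | snocView {l} j
... | inj₁ _ | inj₁ _ = ⇔-id _
... | inj₁ _ | inj₂ _ = ⇔-id _
... | inj₂ _ | inj₁ _ = ⇔-id _
... | inj₂ _ | inj₂ _ = ⇔-id _
R-rotLR {l = l} lo c u R (inj₂ i) (inj₁ j) with snocView {l} i
... | inj₁ _ = ⇔-id _
... | inj₂ _ = ⇔-id _
R-rotLR {l = l} lo c u R (inj₁ i) (inj₂ j) with snocView {l} j
... | inj₁ _ = ⇔-id _
... | inj₂ _ = ⇔-id _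
R-rotLR lo c u R (inj₁ i) (inj₁ j) = ⇔-id _

rotLL-point : ∀ {k l} → Pt k (suc l) → Pt (suc k) l
rotLL-point (inj₁ i) = inj₁ (suc i)
rotLL-point (inj₂ zero) = inj₁ zero
rotLL-point (inj₂ (suc j)) = inj₂ j

ncol-rotLL-point : ∀ {k l} c (lo : Vec Col k) (u : Vec Col l) R x →
  ncol (rotLL c lo u R) x ≡ ncol (mk (c ∷ lo) u R) (rotLL-point x)
ncol-rotLL-point c lo u R (inj₁ i) = refl
ncol-rotLL-point c lo u R (inj₂ zero) = inv-involutive c
ncol-rotLL-point c lo u R (inj₂ (suc j)) = refl

R-rotLL : ∀ {k l} c (lo : Vec Col k) (u : Vec Col l) R x y →
  Part.R (rotLL c lo u R) x y ⇔ R (rotLL-point x) (rotLL-point y)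
R-rotLL c lo u R (inj₁ i) (inj₁ j) = ⇔-id _
R-rotLL c lo u R (inj₁ i) (inj₂ zero) = ⇔-id _
R-rotLL c lo u R (inj₁ i) (inj₂ (suc j)) = ⇔-id _
R-rotLL c lo u R (inj₂ zero) (inj₁ j) = ⇔-id _
R-rotLL c lo u R (inj₂ zero) (inj₂ zero) = ⇔-id _
R-rotLL c lo u R (inj₂ zero) (inj₂ (suc j)) = ⇔-id _
R-rotLL c lo u R (inj₂ (suc i)) (inj₁ j) = ⇔-id _
R-rotLL c lo u R (inj₂ (suc i)) (inj₂ zero) = ⇔-id _
R-rotLL c lo u R (inj₂ (suc i)) (inj₂ (suc j)) = ⇔-id _

module CyclicShift (n : ℕ) .{{_ : NonZero n}} where
  open ModularArithmetic n

  pos<n : ∀ {k l} → k + l ≡ n → (x : Pt k l) → pos x < n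
  pos<n e x = subst (pos x <_) e (pos-< x)

  pointAt% : ∀ {k l} → k + l ≡ n → ℕ → Pt k l
  pointAt% {k} {l} e m = pointAt {k} {l} (m % n) (subst (m % n <_) (sym e) (m%n<n m n))

  pos-pointAt% : ∀ {k l} (e : k + l ≡ n) m → pos (pointAt% {k} {l} e m) ≡ m % n
  pos-pointAt% {k} {l} e m = pos-pointAt {k} {l} (m % n) _

  record Shift (t p : Part) (s : ℕ) : Set where
    field
      size-t : size t ≡ n
      size-p : size p ≡ n
      point : Point t → Point p
      pos-point : ∀ x → pos (point x) ≡ (pos x + s) % n
      ncol-point : ∀ x → ncol t x ≡ ncol p (point x)
      blocks-point : ∀ x y → Cl (R t) x y ⇔ Cl (R p) (point x) (point y)

  module Unshift (t p : Part) (et : size t ≡ n) (s : ℕ) (f : Point t → Point p)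
                 (pos-f : ∀ x → pos (f x) ≡ (pos x + s) % n) where

    unshift : Point p → Point t
    unshift y = pointAt% {k t} {l t} et (pos y + negate s)

    pos-unshift : ∀ y → pos (unshift y) ≡ (pos y + negate s) % n
    pos-unshift y = pos-pointAt% {k t} {l t} et (pos y + negate s)

    f∘unshift : size p ≡ n → ∀ y → f (unshift y) ≡ y
    f∘unshift ep y = pos-injective (begin
      pos (f (unshift y))                 ≡⟨ pos-f (unshift y) ⟩
      (pos (unshift y) + s) % n           ≡⟨ cong (λ m → (m + s) % n) (pos-unshift y) ⟩
      ((pos y + negate s) % n + s) % n    ≡⟨ [[m+negate[s]]%n+s]%n≡m (pos y) s (pos<n ep y) ⟩
      pos y                               ∎)
      where open ≡-Reasoning

    unshift∘f : ∀ x → unshift (f x) ≡ x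
    unshift∘f x = pos-injective (begin
      pos (unshift (f x))                 ≡⟨ pos-unshift (f x) ⟩
      (pos (f x) + negate s) % n          ≡⟨ cong (λ m → (m + negate s) % n) (pos-f x) ⟩
      ((pos x + s) % n + negate s) % n    ≡⟨ [[m+s]%n+negate[s]]%n≡m (pos x) s (pos<n et x) ⟩
      pos x                               ∎)
      where open ≡-Reasoning

  open Shift

  shift-fromRel : ∀ {t p} s (f : Point t → Point p) → size t ≡ n → size p ≡ n →
    (∀ x → pos (f x) ≡ (pos x + s) % n) → (∀ x → ncol t x ≡ ncol p (f x)) →
    (∀ x y → R t x y ⇔ R p (f x) (f y)) → Shift t p s
  shift-fromRel {t} {p} s f et ep pos-f ncol-f rel-f = record
    { size-t = et ; size-p = ep ; point = f ; pos-point = pos-f ; ncol-point = ncol-f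
    ; blocks-point = λ x y → Cl-rel-bijection f unshift unshift∘f (f∘unshift ep) x y ⇔-∘ Cl-cong rel-f x y }
    where open Unshift t p et s f pos-f

  shift-∘ : ∀ {t w p s s′} → Shift t w s → Shift w p s′ → Shift t p (s + s′)
  shift-∘ {t} {w} {p} {s} {s′} t→w w→p = record
    { size-t = size-t t→w ; size-p = size-p w→p
    ; point = point w→p ∘ point t→w
    ; pos-point = λ x → begin
        pos (point w→p (point t→w x))       ≡⟨ pos-point w→p (point t→w x) ⟩
        (pos (point t→w x) + s′) % n        ≡⟨ cong (λ m → (m + s′) % n) (pos-point t→w x) ⟩
        ((pos x + s) % n + s′) % n          ≡⟨ [m%n+o]%n≡[m+o]%n (pos x + s) s′ ⟩
        (pos x + s + s′) % n                ≡⟨ cong (_% n) (+-assoc (pos x) s s′) ⟩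
        (pos x + (s + s′)) % n              ∎
    ; ncol-point = λ x → trans (ncol-point t→w x) (ncol-point w→p (point t→w x))
    ; blocks-point = λ x y → blocks-point w→p _ _ ⇔-∘ blocks-point t→w x y }
    where open ≡-Reasoning

  shift-inverse : ∀ {t p s} → Shift t p s → Shift p t (negate s)
  shift-inverse {t} {p} {s} t→p = record
    { size-t = size-p t→p ; size-p = size-t t→p ; point = unshift ; pos-point = pos-unshift
    ; ncol-point = λ y → trans (cong (ncol p) (sym (f∘unshift′ y))) (sym (ncol-point t→p (unshift y)))
    ; blocks-point = λ y y′ → subst₂ (λ a b → Cl (R p) a b ⇔ Cl (R t) (unshift y) (unshift y′))
                                (f∘unshift′ y) (f∘unshift′ y′) (⇔-sym (blocks-point t→p (unshift y) (unshift y′))) }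
    where
    open Unshift t p (size-t t→p) s (point t→p) (pos-point t→p)
    f∘unshift′ : ∀ y → point t→p (unshift y) ≡ y
    f∘unshift′ = f∘unshift (size-p t→p)

  shift-resp-% : ∀ {t p s s′} → Shift t p s → s % n ≡ s′ % n → Shift t p s′
  shift-resp-% {s = s} {s′} t→p s≡s′ = record
    { size-t = size-t t→p ; size-p = size-p t→p ; point = point t→p
    ; ncol-point = ncol-point t→p ; blocks-point = blocks-point t→p
    ; pos-point = λ x → begin
    pos (point t→p x)   ≡⟨ pos-point t→p x ⟩
    (pos x + s) % n     ≡⟨ [m+o%n]%n≡[m+o]%n (pos x) s ⟨
    (pos x + s % n) % n ≡⟨ cong (λ m → (pos x + m) % n) s≡s′ ⟩
    (pos x + s′ % n) % n ≡⟨ [m+o%n]%n≡[m+o]%n (pos x) s′ ⟩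
    (pos x + s′) % n    ∎ }
    where open ≡-Reasoning

  module _ {k l} (e : suc k + l ≡ n) where

    rotUR-shift : ∀ (lo : Vec Col k) (u : Vec Col l) c R → Shift (rotUR lo u c R) (mk lo (u ∷ʳ c) R) 0
    rotUR-shift lo u c R = shift-fromRel 0 rotUR-point e (trans (+-suc k l) e)
      (λ x → trans (pos-rotUR-point x) (sym (m<n⇒[m+0]%n≡m (pos<n e x))))
      (ncol-rotUR-point lo u c R) (R-rotUR lo u c R)

    rotLR-shift : ∀ (lo : Vec Col k) c (u : Vec Col l) R → Shift (rotLR lo c u R) (mk (lo ∷ʳ c) u R) 0
    rotLR-shift lo c u R = shift-fromRel 0 rotLR-point (trans (+-suc k l) e) e
      (λ x → trans (pos-rotLR-point x) (sym (m<n⇒[m+0]%n≡m (pos<n (trans (+-suc k l) e) x))))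
      (ncol-rotLR-point lo c u R) (R-rotLR lo c u R)

    pos-rotLL-point : ∀ (x : Pt k (suc l)) → pos (rotLL-point x) ≡ (pos x + 1) % n
    pos-rotLL-point (inj₁ i) = sym ([m+1]%n≡1+m (<-≤-trans (s≤s (toℕ<n i)) (subst (suc k ≤_) e (m≤m+n (suc k) l))))
    pos-rotLL-point (inj₂ zero) = sym ([m+1]%n≡0 e)
    pos-rotLL-point (inj₂ (suc j)) = sym ([m+1]%n≡1+m (pos<n e (inj₂ j)))

    rotLL-shift : ∀ c (lo : Vec Col k) (u : Vec Col l) R → Shift (rotLL c lo u R) (mk (c ∷ lo) u R) 1
    rotLL-shift c lo u R = shift-fromRel 1 rotLL-point (trans (+-suc k l) e) e
      pos-rotLL-point (ncol-rotLL-point c lo u R) (R-rotLL c lo u R)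

  module _ (C : Part → Set) (C-resp-≈ : IsSetOfPartitions C) where

    shift-by-0 : ∀ {t p s} → Shift t p s → s % n ≡ 0 → k t ≡ k p → l t ≡ l p → C p → C t
    shift-by-0 {t} {p} {s} t→p s%n≡0 kt≡kp lt≡lp = relabel C C-resp-≈ kt≡kp lt≡lp (point t→p) pos-preserved
      (ncol-point t→p) (blocks-point t→p)
      where
      pos-preserved : ∀ x → pos (point t→p x) ≡ pos x
      pos-preserved x = begin
        pos (point t→p x)   ≡⟨ pos-point t→p x ⟩
        (pos x + s) % n     ≡⟨ o%n≡0⇒[m+o]%n≡m%n (pos x) s s%n≡0 ⟩
        pos x % n           ≡⟨ m<n⇒m%n≡m (pos<n (size-t t→p) x) ⟩
        pos x               ∎
        where open ≡-Reasoning

    module _ (rotations : ClosedRotations C) where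

      private
        rUR : ∀ {k l} (lo : Vec Col k) (u : Vec Col l) c R → C (mk lo (u ∷ʳ c) R) → C (rotUR lo u c R)
        rUR = proj₁ (proj₂ rotations)
        rLL : ∀ {k l} c (lo : Vec Col k) (u : Vec Col l) R → C (mk (c ∷ lo) u R) → C (rotLL c lo u R)
        rLL = proj₁ (proj₂ (proj₂ rotations))
        rLR : ∀ {k l} (lo : Vec Col k) c (u : Vec Col l) R → C (mk (lo ∷ʳ c) u R) → C (rotLR lo c u R)
        rLR = proj₂ (proj₂ (proj₂ rotations))

      -- Upper points are moved to the lower row by rotUR, which keeps positions; a
      -- partition without upper points is advanced by one position by rotLL then rotUR.
      shift-lower→lower : ∀ {k k′} s (lo : Vec Col k) R (lo′ : Vec Col k′) R′ →
        Shift (mk lo′ [] R′) (mk lo [] R) s → C (mk lo [] R) → C (mk lo′ [] R′)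
      shift-lower→lower {k} {k′} zero lo R lo′ R′ t→p Cp = shift-by-0 t→p 0%n≡0
        (+-cancelʳ-≡ 0 k′ k (trans (size-t t→p) (sym (size-p t→p)))) refl Cp
      shift-lower→lower {zero} (suc s) [] R lo′ R′ t→p Cp = ⊥-elim (≢-nonZero⁻¹ n (sym (size-p t→p)))
      shift-lower→lower {suc k} (suc s) (c ∷ lo) R lo′ R′ t→p Cp =
        shift-lower→lower s (lo ∷ʳ inv (inv c)) (Part.R w′) lo′ R′ t→w′
          (rUR lo [] (inv c) (Part.R w) (rLL c lo [] R Cp))
        where
        w w′ : Part
        w = rotLL c lo [] R
        w′ = rotUR lo [] (inv c) (Part.R w)
        t→w′ : Shift (mk lo′ [] R′) w′ s
        t→w′ = shift-resp-% (shift-∘ t→p (shift-inverse (shift-∘ (rotUR-shift (size-p t→p) lo [] (inv c) (Part.R w))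
                                                                  (rotLL-shift (size-p t→p) c lo [] R))))
                            ([1+s+negate[1]]%n≡s%n s)

      shift-→lower : ∀ {k l k′} s (lo : Vec Col k) (u : Vec Col l) R (lo′ : Vec Col k′) R′ →
        Shift (mk lo′ [] R′) (mk lo u R) s → C (mk lo u R) → C (mk lo′ [] R′)
      shift-→lower s lo [] R lo′ R′ t→p Cp = shift-lower→lower s lo R lo′ R′ t→p Cp
      shift-→lower {k} {suc l} s lo u R lo′ R′ t→p Cp with initLast u
      ... | u′ , c , refl = shift-→lower (s + negate 0) (lo ∷ʳ inv c) u′ (Part.R (rotUR lo u′ c R)) lo′ R′
        (shift-∘ t→p (shift-inverse (rotUR-shift (trans (sym (+-suc k l)) (size-p t→p)) lo u′ c R)))
        (rUR lo u′ c R Cp)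

      shift-→any : ∀ {k l k′ l′} s (lo : Vec Col k) (u : Vec Col l) R (lo′ : Vec Col k′) (u′ : Vec Col l′) R′ →
        Shift (mk lo′ u′ R′) (mk lo u R) s → C (mk lo u R) → C (mk lo′ u′ R′)
      shift-→any s lo u R lo′ [] R′ t→p Cp = shift-→lower s lo u R lo′ R′ t→p Cp
      shift-→any {k′ = k′} {suc l′} s lo u R lo′ up R′ t→p Cp with initLast up
      ... | u′ , c , refl = shift-by-0 (shift-inverse z→t) ([s+negate[s]]%n≡0 0) refl refl
                              (rLR lo′ (inv c) u′ (Part.R w) (shift-→any (0 + s) lo u R _ u′ _ (shift-∘ w→t t→p) Cp))
        where
        e : suc k′ + l′ ≡ n
        e = trans (sym (+-suc k′ l′)) (size-t t→p)
        w : Part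
        w = rotUR lo′ u′ c R′
        w→t : Shift w (mk lo′ (u′ ∷ʳ c) R′) 0
        w→t = rotUR-shift e lo′ u′ c R′
        z→t : Shift (rotLR lo′ (inv c) u′ (Part.R w)) (mk lo′ (u′ ∷ʳ c) R′) 0
        z→t = shift-∘ (rotLR-shift e lo′ (inv c) u′ (Part.R w)) w→t

      shift-closed : ∀ {t p s} → Shift t p s → C p → C t
      shift-closed {t} {p} {s} = shift-→any s (lo p) (up p) (R p) (lo t) (up t) (R t)

lookup-reverse-opposite : ∀ {A : Set} {m} (xs : Vec A m) i → lookup (reverse xs) (opposite i) ≡ lookup xs i
lookup-reverse-opposite (x ∷ xs) zero rewrite reverse-∷ x xs = lookup-∷ʳ-fromℕ (reverse xs) x
lookup-reverse-opposite (x ∷ xs) (suc i) rewrite reverse-∷ x xs =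
  trans (lookup-∷ʳ-inject₁ (reverse xs) x (opposite i)) (lookup-reverse-opposite xs i)

oppPt-involutive : ∀ {k l} (x : Pt k l) → oppPt (oppPt x) ≡ x
oppPt-involutive (inj₁ i) = cong inj₁ (opposite-involutive i)
oppPt-involutive (inj₂ j) = cong inj₂ (opposite-involutive j)

module _ (n : ℕ) .{{_ : NonZero n}} {k l} (lo : Vec Col k) (u : Vec Col l) (R : Rel (Pt k l) 0ℓ) (k+l≡n : k + l ≡ n) where
  open CyclicShift n
  open ModularArithmetic n

  private
    p : Part
    p = mk lo u R

    involution-point : Pt l k → Pt k l
    involution-point = oppPt ∘ swapPt

    pos-involution-point : ∀ x → pos (involution-point x) ≡ (pos x + k) % n
    pos-involution-point (inj₁ j) = begin
      pos {k} {l} (inj₂ (opposite j))    ≡⟨ pos-upper (opposite j) ⟩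
      k + toℕ (opposite (opposite j))    ≡⟨ cong (λ i → k + toℕ i) (opposite-involutive j) ⟩
      k + toℕ j                          ≡⟨ +-comm k (toℕ j) ⟩
      toℕ j + k                          ≡⟨ m<n⇒m%n≡m (subst (toℕ j + k <_) (trans (+-comm l k) k+l≡n)
                                                                (+-monoˡ-< k (toℕ<n j))) ⟨
      (toℕ j + k) % n                    ∎
      where open ≡-Reasoning
    pos-involution-point (inj₂ i) = begin
      toℕ (opposite i)                    ≡⟨ m<n⇒m%n≡m (pos<n k+l≡n (inj₁ (opposite i))) ⟨
      toℕ (opposite i) % n                ≡⟨ [m+n]%n≡m%n (toℕ (opposite i)) n ⟨
      (toℕ (opposite i) + n) % n          ≡⟨ cong (λ m → (toℕ (opposite i) + m) % n) (trans (sym k+l≡n) (+-comm k l)) ⟩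
      (toℕ (opposite i) + (l + k)) % n    ≡⟨ cong (_% n) (+-assoc (toℕ (opposite i)) l k) ⟨
      (toℕ (opposite i) + l + k) % n      ≡⟨ cong (λ m → (m + k) % n) (+-comm (toℕ (opposite i)) l) ⟩
      (l + toℕ (opposite i) + k) % n      ≡⟨ cong (λ m → (m + k) % n) (pos-upper i) ⟨
      (pos {l} {k} (inj₂ i) + k) % n      ∎
      where open ≡-Reasoning

    ncol-involution-point : ∀ x → ncol (p *) x ≡ ncol (vreflect p) (involution-point x)
    ncol-involution-point (inj₁ j) = sym (begin
      inv (lookup (reverse (map inv u)) (opposite j))   ≡⟨ cong inv (lookup-reverse-opposite (map inv u) j) ⟩
      inv (lookup (map inv u) j)                        ≡⟨ cong inv (lookup-map j inv u) ⟩
      inv (inv (lookup u j))                            ≡⟨ inv-involutive _ ⟩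
      lookup u j                                        ∎)
      where open ≡-Reasoning
    ncol-involution-point (inj₂ i) = sym (trans (lookup-reverse-opposite (map inv lo) i) (lookup-map i inv lo))

    R-involution-point : ∀ x y → Part.R (p *) x y ⇔ Part.R (vreflect p) (involution-point x) (involution-point y)
    R-involution-point x y = subst₂ (λ a b → R (swapPt x) (swapPt y) ⇔ R a b)
      (sym (oppPt-involutive (swapPt x))) (sym (oppPt-involutive (swapPt y))) (⇔-id _)

  involution-shift : Shift (p *) (vreflect p) k
  involution-shift = shift-fromRel k involution-point (trans (+-comm l k) k+l≡n) k+l≡n
    pos-involution-point ncol-involution-point R-involution-point

module _ (C : Part → Set) (C-resp-≈ : IsSetOfPartitions C) where

  empty-closed : ∀ {t p} → size t ≡ 0 → size p ≡ 0 → C p → C t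
  empty-closed {mk {zero} {zero} [] [] R′} {mk {zero} {zero} [] [] R} _ _ =
    C-resp-≈ (same λ { (inj₁ ()) ; (inj₂ ()) })

  rotations+verticolor⇒involution : ClosedRotations C → ClosedVerticolor C → ClosedInvolution C
  rotations+verticolor⇒involution rotations vreflect-closed p@(mk {k} {l} lo u R) Cp with size p in e
  ... | zero = empty-closed (trans (+-comm l k) e) e Cp
  ... | suc n′ = CyclicShift.shift-closed (suc n′) C C-resp-≈ rotations
                   (involution-shift (suc n′) lo u R e) (vreflect-closed p Cp)

  rotations+involution⇒verticolor : ClosedRotations C → ClosedInvolution C → ClosedVerticolor C
  rotations+involution⇒verticolor rotations involution-closed p@(mk {k} {l} lo u R) Cp with size p in e
  ... | zero = empty-closed e e Cp
  ... | suc n′ = CyclicShift.shift-closed (suc n′) C C-resp-≈ rotations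
                   (CyclicShift.shift-inverse (suc n′) (involution-shift (suc n′) lo u R e)) (involution-closed p Cp)

undeleteLo : ∀ {k l} (lo : Vec Col k) (u : Vec Col l) R i → Point (deleteLo lo u R i) → Pt k l
undeleteLo {suc k} lo u R i (inj₁ a) = inj₁ (punchIn i a)
undeleteLo {suc k} lo u R i (inj₂ b) = inj₂ b

undeleteUp : ∀ {k l} (lo : Vec Col k) (u : Vec Col l) R j → Point (deleteUp lo u R j) → Pt k l
undeleteUp {k} {suc l} lo u R j (inj₁ a) = inj₁ a
undeleteUp {k} {suc l} lo u R j (inj₂ b) = inj₂ (punchIn j b)

undelete : ∀ {k l} (lo : Vec Col k) (u : Vec Col l) R γ → Point (deleteC lo u R γ) → Pt k l
undelete lo u R (inj₁ i) = undeleteLo lo u R i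
undelete lo u R (inj₂ j) = undeleteUp lo u R j

R-deleteC : ∀ {k l} (lo : Vec Col k) (u : Vec Col l) R γ x y →
  Part.R (deleteC lo u R γ) x y ⇔ Cl R (undelete lo u R γ x) (undelete lo u R γ y)
R-deleteC {suc k} lo u R (inj₁ i) (inj₁ a) (inj₁ b) = ⇔-id _
R-deleteC {suc k} lo u R (inj₁ i) (inj₁ a) (inj₂ b) = ⇔-id _
R-deleteC {suc k} lo u R (inj₁ i) (inj₂ a) (inj₁ b) = ⇔-id _
R-deleteC {suc k} lo u R (inj₁ i) (inj₂ a) (inj₂ b) = ⇔-id _
R-deleteC {k} {suc l} lo u R (inj₂ j) (inj₁ a) (inj₁ b) = ⇔-id _
R-deleteC {k} {suc l} lo u R (inj₂ j) (inj₁ a) (inj₂ b) = ⇔-id _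
R-deleteC {k} {suc l} lo u R (inj₂ j) (inj₂ a) (inj₁ b) = ⇔-id _
R-deleteC {k} {suc l} lo u R (inj₂ j) (inj₂ a) (inj₂ b) = ⇔-id _

blocks-deleteC : ∀ {k l} (lo : Vec Col k) (u : Vec Col l) R γ x y →
  Cl (Part.R (deleteC lo u R γ)) x y ⇔ Cl R (undelete lo u R γ x) (undelete lo u R γ y)
blocks-deleteC lo u R γ x y = Cl-rel-Cl (undelete lo u R γ) x y ⇔-∘ Cl-cong (R-deleteC lo u R γ) x y

lookup-removeAt : ∀ {A : Set} {m} (xs : Vec A (suc m)) i a → lookup (removeAt xs i) a ≡ lookup xs (punchIn i a)
lookup-removeAt (x ∷ xs) zero a = refl
lookup-removeAt (x ∷ y ∷ xs) (suc i) zero = refl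
lookup-removeAt (x ∷ y ∷ xs) (suc i) (suc a) = lookup-removeAt (y ∷ xs) i a

ncol-deleteC : ∀ {k l} (lo : Vec Col k) (u : Vec Col l) R γ x →
  ncol (deleteC lo u R γ) x ≡ ncol (mk lo u R) (undelete lo u R γ x)
ncol-deleteC {suc k} lo u R (inj₁ i) (inj₁ a) = lookup-removeAt lo i a
ncol-deleteC {suc k} lo u R (inj₁ i) (inj₂ b) = refl
ncol-deleteC {k} {suc l} lo u R (inj₂ j) (inj₁ a) = refl
ncol-deleteC {k} {suc l} lo u R (inj₂ j) (inj₂ b) = cong inv (lookup-removeAt u j b)

size-deleteC : ∀ {k l} (lo : Vec Col k) (u : Vec Col l) R γ → suc (size (deleteC lo u R γ)) ≡ k + l
size-deleteC {suc k} lo u R (inj₁ i) = refl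
size-deleteC {k} {suc l} lo u R (inj₂ j) = sym (+-suc k l)

undelete-shiftC : ∀ {k l} (lo : Vec Col k) (u : Vec Col l) R α β (α≢β : α ≢ β) →
  undelete lo u R α (shiftC lo u R α β α≢β) ≡ β
undelete-shiftC {suc k} lo u R (inj₁ i) (inj₁ j) α≢β = cong inj₁ (punchIn-punchOut (α≢β ∘ cong inj₁))
undelete-shiftC {suc k} lo u R (inj₁ i) (inj₂ j) α≢β = refl
undelete-shiftC {suc k} {suc l} lo u R (inj₂ i) (inj₁ j) α≢β = refl
undelete-shiftC {zero} {suc l} lo u R (inj₂ i) (inj₂ j) α≢β = cong inj₂ (punchIn-punchOut (α≢β ∘ cong inj₂))
undelete-shiftC {suc k} {suc l} lo u R (inj₂ i) (inj₂ j) α≢β = cong inj₂ (punchIn-punchOut (α≢β ∘ cong inj₂))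

toℕ-punchIn : ∀ {m} (i : Fin (suc m)) (a : Fin m) →
  (toℕ a < toℕ i × toℕ (punchIn i a) ≡ toℕ a) ⊎ (toℕ i ≤ toℕ a × toℕ (punchIn i a) ≡ suc (toℕ a))
toℕ-punchIn zero a = inj₂ (z≤n , refl)
toℕ-punchIn (suc i) zero = inj₁ (s≤s z≤n , refl)
toℕ-punchIn (suc i) (suc a) with toℕ-punchIn i a
... | inj₁ (a<i , e) = inj₁ (s≤s a<i , cong suc e)
... | inj₂ (i≤a , e) = inj₂ (s≤s i≤a , cong suc e)

pos-undelete : ∀ {k l} (lo : Vec Col k) (u : Vec Col l) R γ x →
  (pos x < pos γ × pos (undelete lo u R γ x) ≡ pos x) ⊎ (pos γ ≤ pos x × pos (undelete lo u R γ x) ≡ suc (pos x))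
pos-undelete {suc k} lo u R (inj₁ i) (inj₁ a) = toℕ-punchIn i a
pos-undelete {suc k} lo u R (inj₁ i) (inj₂ b) = inj₂ (≤-trans (<⇒≤pred (toℕ<n i)) (m≤m+n k _) , refl)
pos-undelete {k} {suc l} lo u R (inj₂ j) (inj₁ a) = inj₁ (lower-<-upper a j , refl)
pos-undelete {k} {suc l} lo u R (inj₂ j) (inj₂ b) with toℕ-punchIn j b
... | inj₁ (b<j , e) = inj₂ (+-monoʳ-≤ k (∸-monoʳ-≤ l b<j) , (begin
  k + (l ∸ toℕ (punchIn j b))   ≡⟨ cong (λ z → k + (l ∸ z)) e ⟩
  k + (l ∸ toℕ b)               ≡⟨ cong (k +_) (+-∸-assoc 1 (toℕ<n b)) ⟩
  k + suc (l ∸ suc (toℕ b))     ≡⟨ +-suc k _ ⟩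
  suc (k + (l ∸ suc (toℕ b)))   ∎))
  where open ≡-Reasoning
... | inj₂ (j≤b , e) = inj₁ (+-monoʳ-< k (∸-monoʳ-< (s≤s j≤b) (toℕ<n b)) , cong (λ z → k + (l ∸ z)) e)

module Erase {k l} (lo : Vec Col k) (u : Vec Col l) (R : Rel (Pt k l) 0ℓ) (α β : Pt k l) (α≢β : α ≢ β) where
  open Merge R α β public

  private
    p p′ p₁ : Part
    p = mk lo u R
    p′ = merge p α β
    p₁ = deleteC lo u (Part.R p′) α
    β′ : Point p₁
    β′ = shiftC lo u (Part.R p′) α β α≢β
    undelete₁ : Point p₁ → Pt k l
    undelete₁ = undelete lo u (Part.R p′) α
    undelete₂ : Point (deleteC (Part.lo p₁) (Part.up p₁) (Part.R p₁) β′) → Point p₁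
    undelete₂ = undelete (Part.lo p₁) (Part.up p₁) (Part.R p₁) β′

  erased : Part
  erased = erase p α β α≢β

  erase-point : Point erased → Pt k l
  erase-point = undelete₁ ∘ undelete₂

  blocks-erase : ∀ x y → Cl (Part.R erased) x y ⇔ Merged (erase-point x) (erase-point y)
  blocks-erase x y = begin
    Cl (Part.R erased) x y                           ≈⟨ blocks-deleteC (Part.lo p₁) (Part.up p₁) (Part.R p₁) β′ x y ⟩
    Cl (Part.R p₁) (undelete₂ x) (undelete₂ y)       ≈⟨ blocks-deleteC lo u (Part.R p′) α _ _ ⟩
    Cl (Part.R p′) (erase-point x) (erase-point y)   ≈⟨ Cl-merge _ _ ⟩
    Merged (erase-point x) (erase-point y)           ∎
    where open ⇔-Reasoning

  ncol-erase : ∀ x → ncol erased x ≡ ncol p (erase-point x)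
  ncol-erase x = trans (ncol-deleteC (Part.lo p₁) (Part.up p₁) (Part.R p₁) β′ x)
                       (trans (ncol-deleteC lo u (Part.R p′) α (undelete₂ x)) (ncol-merge (erase-point x)))
    where
    ncol-merge : ∀ z → ncol p′ z ≡ ncol p z
    ncol-merge (inj₁ i) = refl
    ncol-merge (inj₂ j) = refl

  size-erase : suc (suc (size erased)) ≡ k + l
  size-erase = trans (cong suc (size-deleteC (Part.lo p₁) (Part.up p₁) (Part.R p₁) β′)) (size-deleteC lo u (Part.R p′) α)

  private
    undelete₁-β′ : undelete₁ β′ ≡ β
    undelete₁-β′ = undelete-shiftC lo u (Part.R p′) α β α≢β

  private
    pos-β′ : suc (pos α) ≡ pos β → pos β′ ≡ pos α
    pos-β′ 1+α≡β with pos-undelete lo u (Part.R p′) α β′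
    ... | inj₁ (β′<α , e) =
      ⊥-elim (<-asym β′<α (subst (pos α <_) (trans 1+α≡β (trans (cong pos (sym undelete₁-β′)) e)) ≤-refl))
    ... | inj₂ (_ , e) = suc-injective (trans (sym e) (trans (cong pos undelete₁-β′) (sym 1+α≡β)))

  pos-erase-point-adjacent : suc (pos α) ≡ pos β → ∀ x →
    (pos x < pos α × pos (erase-point x) ≡ pos x) ⊎ (pos α ≤ pos x × pos (erase-point x) ≡ suc (suc (pos x)))
  pos-erase-point-adjacent 1+α≡β x with pos-β′ 1+α≡β | pos-undelete (Part.lo p₁) (Part.up p₁) (Part.R p₁) β′ x
                                      | pos-undelete lo u (Part.R p′) α (undelete₂ x)
  ... | β′≡α | inj₁ (x<β′ , e₂) | inj₁ (_ , e₁) = inj₁ (subst (pos x <_) β′≡α x<β′ , trans e₁ e₂)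
  ... | β′≡α | inj₁ (x<β′ , e₂) | inj₂ (α≤ , _) =
    ⊥-elim (<-irrefl refl (<-≤-trans (subst (pos x <_) β′≡α x<β′) (subst (pos α ≤_) e₂ α≤)))
  ... | β′≡α | inj₂ (β′≤x , e₂) | inj₁ (<α , _) =
    ⊥-elim (<-irrefl refl (<-≤-trans (subst (_< pos α) e₂ <α) (≤-trans (subst (_≤ pos x) β′≡α β′≤x) (n≤1+n _))))
  ... | β′≡α | inj₂ (β′≤x , e₂) | inj₂ (_ , e₁) = inj₂ (subst (_≤ pos x) β′≡α β′≤x , trans e₁ (cong suc e₂))

  private
    pos-β′-wrap : pos β ≡ 0 → pos β′ ≡ 0
    pos-β′-wrap β≡0 with pos-undelete lo u (Part.R p′) α β′
    ... | inj₁ (_ , e) = trans (sym e) (trans (cong pos undelete₁-β′) β≡0)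
    ... | inj₂ (_ , e) with trans (sym e) (trans (cong pos undelete₁-β′) β≡0)
    ... | ()

  pos-erase-point-wrap : suc (pos α) ≡ k + l → pos β ≡ 0 → ∀ x → pos (erase-point x) ≡ suc (pos x)
  pos-erase-point-wrap 1+α≡size β≡0 x with pos-β′-wrap β≡0
                                         | pos-undelete (Part.lo p₁) (Part.up p₁) (Part.R p₁) β′ x
  ... | β′≡0 | inj₁ (x<β′ , _) with subst (pos x <_) β′≡0 x<β′
  ... | ()
  pos-erase-point-wrap 1+α≡size β≡0 x | β′≡0 | inj₂ (_ , e₂) with pos-undelete lo u (Part.R p′) α (undelete₂ x)
  ... | inj₁ (_ , e₁) = trans e₁ e₂
  ... | inj₂ (α≤ , _) = ⊥-elim (<-irrefl refl (<-≤-trans 2+x<1+α (s≤s (subst (pos α ≤_) e₂ α≤))))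
    where
    2+x<1+α : suc (suc (pos x)) < suc (pos α)
    2+x<1+α = subst (suc (suc (pos x)) <_) (trans size-erase (sym 1+α≡size)) (s≤s (s≤s (pos-< x)))

rotUL-point : ∀ {k l} → Pt (suc k) l → Pt k (suc l)
rotUL-point (inj₁ zero) = inj₂ zero
rotUL-point (inj₁ (suc i)) = inj₁ i
rotUL-point (inj₂ j) = inj₂ (suc j)

R-rotUL : ∀ {k l} (lo : Vec Col k) c (u : Vec Col l) R x y →
  Part.R (rotUL lo c u R) x y ⇔ R (rotUL-point x) (rotUL-point y)
R-rotUL lo c u R (inj₁ zero) (inj₁ zero) = ⇔-id _
R-rotUL lo c u R (inj₁ zero) (inj₁ (suc j)) = ⇔-id _
R-rotUL lo c u R (inj₁ zero) (inj₂ j) = ⇔-id _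
R-rotUL lo c u R (inj₁ (suc i)) (inj₁ zero) = ⇔-id _
R-rotUL lo c u R (inj₁ (suc i)) (inj₁ (suc j)) = ⇔-id _
R-rotUL lo c u R (inj₁ (suc i)) (inj₂ j) = ⇔-id _
R-rotUL lo c u R (inj₂ i) (inj₁ zero) = ⇔-id _
R-rotUL lo c u R (inj₂ i) (inj₁ (suc j)) = ⇔-id _
R-rotUL lo c u R (inj₂ i) (inj₂ j) = ⇔-id _

rotUL-point∘rotLL-point : ∀ {k l} (x : Pt k (suc l)) → rotUL-point (rotLL-point x) ≡ x
rotUL-point∘rotLL-point (inj₁ i) = refl
rotUL-point∘rotLL-point (inj₂ zero) = refl
rotUL-point∘rotLL-point (inj₂ (suc j)) = refl

rotLL-point∘rotUL-point : ∀ {k l} (x : Pt (suc k) l) → rotLL-point (rotUL-point x) ≡ x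
rotLL-point∘rotUL-point (inj₁ zero) = refl
rotLL-point∘rotUL-point (inj₁ (suc i)) = refl
rotLL-point∘rotUL-point (inj₂ j) = refl

-- Rotating the first middle point out of both factors and composing along the rest leaves
-- its two rotated copies as the turn {first upper point, first lower point}.
module CompositionStep {k m l} (c : Col) (lo : Vec Col k) (mi : Vec Col m) (u : Vec Col l)
                       (R : Rel (Pt k (suc m)) 0ℓ) (R′ : Rel (Pt (suc m) l) 0ℓ) where

  Rᵤ : Rel (Pt (suc k) m) 0ℓ
  Rᵤ = Part.R (rotUL lo c mi R)
  R′ₗ : Rel (Pt m (suc l)) 0ℓ
  R′ₗ = Part.R (rotLL c mi u R′)

  rotated : Part
  rotated = compose (inv c ∷ lo) mi (inv c ∷ u) Rᵤ R′ₗ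

  private
    Big Small : Set
    Big = MPt (suc k) m (suc l)
    Small = MPt k (suc m) l
    U-big : Rel Big 0ℓ
    U-big = Union Rᵤ R′ₗ
    U-small : Rel Small 0ℓ
    U-small = Union R R′
    open Merge U-big (high zero) (low zero)

    collapse : Big → Small
    collapse (low zero) = mid zero
    collapse (low (suc i)) = low i
    collapse (mid j) = mid (suc j)
    collapse (high zero) = mid zero
    collapse (high (suc v)) = high v

    collapse-embL : ∀ x → collapse (embL x) ≡ embL (rotUL-point x)
    collapse-embL (inj₁ zero) = refl
    collapse-embL (inj₁ (suc i)) = refl
    collapse-embL (inj₂ j) = refl

    collapse-embU : ∀ x → collapse (embU x) ≡ embU (rotLL-point x)
    collapse-embU (inj₁ j) = refl
    collapse-embU (inj₂ zero) = refl
    collapse-embU (inj₂ (suc v)) = refl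

    collapse-resp : ∀ {a b} → U-big a b → Cl U-small (collapse a) (collapse b)
    collapse-resp (fromL x y r) rewrite collapse-embL x | collapse-embL y =
      EqClosure.return (fromL _ _ (to (R-rotUL lo c mi R x y) r))
    collapse-resp (fromU x y r) rewrite collapse-embU x | collapse-embU y =
      EqClosure.return (fromU _ _ (to (R-rotLL c mi u R′ x y) r))

    expand : Small → Big
    expand (low i) = low (suc i)
    expand (mid zero) = low zero
    expand (mid (suc j)) = mid j
    expand (high v) = high (suc v)

    expand-embL : ∀ x → expand (embL x) ≡ embL (rotLL-point x)
    expand-embL (inj₁ i) = refl
    expand-embL (inj₂ zero) = refl
    expand-embL (inj₂ (suc j)) = refl

    expand-embU : ∀ x → Merged (expand (embU x)) (embU (rotUL-point x))
    expand-embU (inj₁ zero) = inj₂ (inj₂ Cl-refl , inj₁ Cl-refl)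
    expand-embU (inj₁ (suc j)) = inj₁ Cl-refl
    expand-embU (inj₂ v) = inj₁ Cl-refl

    open IsEquivalence Merged-isEquivalence using () renaming (sym to Merged-sym; trans to Merged-trans)

    expand-resp : ∀ {a b} → U-small a b → Merged (expand a) (expand b)
    expand-resp (fromL x y r) rewrite expand-embL x | expand-embL y =
      inj₁ (EqClosure.return (fromL _ _ (from (R-rotUL lo c mi R (rotLL-point x) (rotLL-point y))
             (subst₂ R (sym (rotUL-point∘rotLL-point x)) (sym (rotUL-point∘rotLL-point y)) r))))
    expand-resp (fromU x y r) = Merged-trans (expand-embU x) (Merged-trans
      (inj₁ (EqClosure.return (fromU _ _ (from (R-rotLL c mi u R′ (rotUL-point x) (rotUL-point y))
              (subst₂ R′ (sym (rotLL-point∘rotUL-point x)) (sym (rotLL-point∘rotUL-point y)) r)))))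
      (Merged-sym (expand-embU y)))

    expand∘collapse : ∀ a → Merged a (expand (collapse a))
    expand∘collapse (low zero) = inj₁ Cl-refl
    expand∘collapse (low (suc i)) = inj₁ Cl-refl
    expand∘collapse (mid j) = inj₁ Cl-refl
    expand∘collapse (high zero) = inj₂ (inj₁ Cl-refl , inj₂ Cl-refl)
    expand∘collapse (high (suc v)) = inj₁ Cl-refl

    touches-collapse : ∀ {a} → Touches a → Cl U-small (collapse a) (mid zero)
    touches-collapse (inj₁ q) = Cl-gbind collapse collapse-resp q
    touches-collapse (inj₂ q) = Cl-gbind collapse collapse-resp q

    Merged⇔collapse : ∀ a b → Merged a b ⇔ Cl U-small (collapse a) (collapse b)
    Merged⇔collapse a b = mk⇔ to′ from′
      where
      to′ : Merged a b → Cl U-small (collapse a) (collapse b)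
      to′ (inj₁ q) = Cl-gbind collapse collapse-resp q
      to′ (inj₂ (ta , tb)) = Cl-trans (touches-collapse ta) (Cl-sym (touches-collapse tb))
      from′ : Cl U-small (collapse a) (collapse b) → Merged a b
      from′ q = Merged-trans (expand∘collapse a) (Merged-trans
        (EqClosure.gfold Merged-isEquivalence expand expand-resp q) (Merged-sym (expand∘collapse b)))

  private
    inv∘inv≢inv : ∀ d → inv (inv d) ≢ inv d
    inv∘inv≢inv white ()
    inv∘inv≢inv black ()

  turn : Turn rotated (inj₂ zero) (inj₁ zero)
  turn = inj₂ (sym (+-suc (suc k) l) , refl) , (λ ()) , inv∘inv≢inv c

  private
    open Erase (inv c ∷ lo) (inv c ∷ u) (Part.R rotated) (inj₂ zero) (inj₁ zero) (λ ())
      using (erased; erase-point; blocks-erase)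

    collapse-erase-point : ∀ x → collapse (outer (erase-point x)) ≡ outer x
    collapse-erase-point (inj₁ i) = refl
    collapse-erase-point (inj₂ j) = refl

  erase-rotated≈compose : erased ≈ compose lo (c ∷ mi) u R R′
  erase-rotated≈compose = ≈-from-Cl⇔ λ x y → begin
    Cl (Part.R erased) x y
      ≈⟨ blocks-erase x y ⟩
    Merge.Merged (Part.R rotated) (inj₂ zero) (inj₁ zero) (erase-point x) (erase-point y)
      ≈⟨ Merged-transport outer (Cl-rel-Cl outer) (inj₂ zero) (inj₁ zero) (erase-point x) (erase-point y) ⟩
    Merged (outer (erase-point x)) (outer (erase-point y))
      ≈⟨ Merged⇔collapse _ _ ⟩
    Cl U-small (collapse (outer (erase-point x))) (collapse (outer (erase-point y)))
      ≡⟨ cong₂ (Cl U-small) (collapse-erase-point x) (collapse-erase-point y) ⟩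
    Cl U-small (outer x) (outer y)
      ≈⟨ Cl-rel-Cl outer x y ⟨
    Cl (Part.R (compose lo (c ∷ mi) u R R′)) x y
      ∎
    where open ⇔-Reasoning

module EmptyMiddle {k l} (lo : Vec Col k) (u : Vec Col l) (R : Rel (Pt k 0) 0ℓ) (R′ : Rel (Pt 0 l) 0ℓ) where

  tensor : Part
  tensor = mk lo [] R ⊗ mk [] u R′

  toTensor : Pt k l → Pt (k + 0) l
  toTensor (inj₁ i) = inj₁ (i ↑ˡ 0)
  toTensor (inj₂ j) = inj₂ j

  private
    fromTensor : Pt (k + 0) l → Pt k l
    fromTensor (inj₁ z) with splitAt k {0} z
    ... | inj₁ i = inj₁ i
    fromTensor (inj₂ j) = inj₂ j

    fromTensor∘toTensor : ∀ x → fromTensor (toTensor x) ≡ x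
    fromTensor∘toTensor (inj₁ i) rewrite splitAt-↑ˡ k i 0 = refl
    fromTensor∘toTensor (inj₂ j) = refl

    toTensor∘fromTensor : ∀ x → toTensor (fromTensor x) ≡ x
    toTensor∘fromTensor (inj₁ z) with splitAt k {0} z in e
    ... | inj₁ i = cong inj₁ (splitAt⁻¹-↑ˡ e)
    toTensor∘fromTensor (inj₂ j) = refl

    factor : Pt k l → Pt k 0 ⊎ Pt 0 l
    factor (inj₁ i) = inj₁ (inj₁ i)
    factor (inj₂ j) = inj₂ (inj₂ j)

    Separate : Rel (Pt k l) 0ℓ
    Separate x y = Pointwise R R′ (factor x) (factor y)

    side-toTensor : ∀ x → side {k} {0} {0} {l} (toTensor x) ≡ factor x
    side-toTensor (inj₁ i) rewrite splitAt-↑ˡ k i 0 = refl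
    side-toTensor (inj₂ j) = refl

    R-tensor : ∀ x y → Separate x y ⇔ Part.R tensor (toTensor x) (toTensor y)
    R-tensor x y rewrite side-toTensor x | side-toTensor y = ⇔-id _

    glue : MPt k 0 l → Pt k l
    glue (low i) = inj₁ i
    glue (high j) = inj₂ j

    outer-resp : ∀ {x y} → Separate x y → Cl (Union R R′) (outer x) (outer y)
    outer-resp {inj₁ i} {inj₁ j} (PW.inj₁ r) = EqClosure.return (fromL (inj₁ i) (inj₁ j) r)
    outer-resp {inj₂ i} {inj₂ j} (PW.inj₂ r) = EqClosure.return (fromU (inj₂ i) (inj₂ j) r)

    glue-resp : ∀ {a b} → Union R R′ a b → Cl Separate (glue a) (glue b)
    glue-resp (fromL (inj₁ i) (inj₁ j) r) = EqClosure.return (PW.inj₁ r)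
    glue-resp (fromU (inj₂ i) (inj₂ j) r) = EqClosure.return (PW.inj₂ r)

    glue∘outer : ∀ x → Cl Separate x (glue (outer x))
    glue∘outer (inj₁ i) = Cl-refl
    glue∘outer (inj₂ j) = Cl-refl

  blocks-toTensor : ∀ x y → Cl (Part.R (compose lo [] u R R′)) x y ⇔ Cl (Part.R tensor) (toTensor x) (toTensor y)
  blocks-toTensor x y = begin
    Cl (Part.R (compose lo [] u R R′)) x y          ≈⟨ Cl-rel-Cl outer x y ⟩
    Cl (Union R R′) (outer x) (outer y)             ≈⟨ Cl-⇔-quasiInverse outer glue outer-resp glue-resp glue∘outer x y ⟨
    Cl Separate x y                                 ≈⟨ Cl-cong R-tensor x y ⟩
    Cl (rel toTensor (Part.R tensor)) x y           ≈⟨ Cl-rel-bijection toTensor fromTensor fromTensor∘toTensor toTensor∘fromTensor x y ⟩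
    Cl (Part.R tensor) (toTensor x) (toTensor y)    ∎
    where open ⇔-Reasoning

  pos-toTensor : ∀ x → pos (toTensor x) ≡ pos x
  pos-toTensor (inj₁ i) = toℕ-↑ˡ i 0
  pos-toTensor (inj₂ j) = cong (_+ _) (+-identityʳ k)

  ncol-toTensor : ∀ x → ncol (compose lo [] u R R′) x ≡ ncol tensor (toTensor x)
  ncol-toTensor (inj₁ i) = sym (lookup-++ˡ lo [] i)
  ncol-toTensor (inj₂ j) = refl

module _ (C : Part → Set) (C-resp-≈ : IsSetOfPartitions C) where

  erasing⇒composition : ClosedTensor C → ClosedRotations C → ClosedErasingTurns C → ClosedComposition C
  erasing⇒composition tensor-closed _ _ {k} lo [] u R R′ Cp Cq =
    relabel C C-resp-≈ (sym (+-identityʳ k)) refl toTensor pos-toTensor ncol-toTensor blocks-toTensor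
      (tensor-closed _ _ Cp Cq)
    where open EmptyMiddle lo u R R′
  erasing⇒composition tensor-closed rotations@(rUL , _ , rLL , _) erase-closed lo (c ∷ mi) u R R′ Cp Cq =
    C-resp-≈ erase-rotated≈compose (erase-closed rotated (inj₂ zero) (inj₁ zero) turn
      (erasing⇒composition tensor-closed rotations erase-closed (inv c ∷ lo) mi (inv c ∷ u) Rᵤ R′ₗ
        (rUL lo c mi R Cp) (rLL c mi u R′ Cq)))
    where open CompositionStep c lo mi u R R′

-- The identity partition on m points, defined as an iterated tensor product of one-block
-- pairs so that it lies in every category.
idR : (m : ℕ) → Rel (Pt m m) 0ℓ
idR zero _ _ = ⊥
idR (suc m) x y = Pointwise (λ _ _ → ⊤) (idR m) (side {1} {m} {1} {m} x) (side {1} {m} {1} {m} y)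

idx : ∀ {m} → Pt m m → Fin m
idx (inj₁ i) = i
idx (inj₂ j) = j

idR-diag : ∀ m (i : Fin m) → idR m (inj₁ i) (inj₂ i)
idR-diag (suc m) zero = PW.inj₁ tt
idR-diag (suc m) (suc i) = PW.inj₂ (idR-diag m i)

idR⇒idx≡ : ∀ m {x y : Pt m m} → idR m x y → idx x ≡ idx y
idR⇒idx≡ (suc m) {x} {y} r = trans (idx-side x) (trans (sides r) (sym (idx-side y)))
  where
  idxˢ : Pt 1 1 ⊎ Pt m m → Fin (suc m)
  idxˢ (inj₁ _) = zero
  idxˢ (inj₂ z) = suc (idx z)
  idx-side : ∀ z → idx z ≡ idxˢ (side {1} {m} {1} {m} z)
  idx-side (inj₁ zero) = refl
  idx-side (inj₁ (suc i)) = refl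
  idx-side (inj₂ zero) = refl
  idx-side (inj₂ (suc j)) = refl
  sides : ∀ {a b} → Pointwise (λ _ _ → ⊤) (idR m) a b → idxˢ a ≡ idxˢ b
  sides (PW.inj₁ _) = refl
  sides (PW.inj₂ r) = cong suc (idR⇒idx≡ m r)

module RotUL {k l} (lo : Vec Col k) (c : Col) (u : Vec Col l) (R : Rel (Pt k (suc l)) 0ℓ) where

  lower upper : Part
  lower = idP (inv c) ⊗ mk lo (c ∷ u) R
  upper = pairP (inv c) c ⊗ mk u u (idR l)

  composite : Part
  composite = compose (inv c ∷ lo) (inv c ∷ c ∷ u) u (Part.R lower) (Part.R upper)

  private
    U : Rel (MPt (suc k) (suc (suc l)) l) 0ℓ
    U = Union (Part.R lower) (Part.R upper)

    fold : MPt (suc k) (suc (suc l)) l → Pt k (suc l)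
    fold (low zero) = inj₂ zero
    fold (low (suc i)) = inj₁ i
    fold (mid zero) = inj₂ zero
    fold (mid (suc j)) = inj₂ j
    fold (high j) = inj₂ (suc j)

    foldˡ : Pt 1 1 ⊎ Pt k (suc l) → Pt k (suc l)
    foldˡ (inj₁ _) = inj₂ zero
    foldˡ (inj₂ z) = z

    fold-embL : ∀ x → fold (embL x) ≡ foldˡ (side {1} {k} {1} {suc l} x)
    fold-embL (inj₁ zero) = refl
    fold-embL (inj₁ (suc i)) = refl
    fold-embL (inj₂ zero) = refl
    fold-embL (inj₂ (suc j)) = refl

    foldᵘ : Pt 2 0 ⊎ Pt l l → Pt k (suc l)
    foldᵘ (inj₁ _) = inj₂ zero
    foldᵘ (inj₂ z) = inj₂ (suc (idx z))

    fold-embU : ∀ x → fold (embU x) ≡ foldᵘ (side {2} {l} {0} {l} x)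
    fold-embU (inj₁ zero) = refl
    fold-embU (inj₁ (suc zero)) = refl
    fold-embU (inj₁ (suc (suc j))) = refl
    fold-embU (inj₂ j) = refl

    foldˡ-resp : ∀ {a b} → Pointwise (λ _ _ → ⊤) R a b → Cl R (foldˡ a) (foldˡ b)
    foldˡ-resp (PW.inj₁ _) = Cl-refl
    foldˡ-resp (PW.inj₂ r) = EqClosure.return r

    foldᵘ-resp : ∀ {a b} → Pointwise (λ _ _ → ⊤) (idR l) a b → Cl R (foldᵘ a) (foldᵘ b)
    foldᵘ-resp (PW.inj₁ _) = Cl-refl
    foldᵘ-resp (PW.inj₂ r) = Cl-reflexive (cong (inj₂ ∘ suc) (idR⇒idx≡ l r))

    fold-resp : ∀ {a b} → U a b → Cl R (fold a) (fold b)
    fold-resp (fromL x y r) = subst₂ (Cl R) (sym (fold-embL x)) (sym (fold-embL y)) (foldˡ-resp r)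
    fold-resp (fromU x y r) = subst₂ (Cl R) (sym (fold-embU x)) (sym (fold-embU y)) (foldᵘ-resp r)

    unfold : Pt k (suc l) → MPt (suc k) (suc (suc l)) l
    unfold (inj₁ i) = low (suc i)
    unfold (inj₂ j) = mid (suc j)

    unfold-resp : ∀ {x y} → R x y → Cl U (unfold x) (unfold y)
    unfold-resp {inj₁ i} {inj₁ j} r = EqClosure.return (fromL (inj₁ (suc i)) (inj₁ (suc j)) (PW.inj₂ r))
    unfold-resp {inj₁ i} {inj₂ j} r = EqClosure.return (fromL (inj₁ (suc i)) (inj₂ (suc j)) (PW.inj₂ r))
    unfold-resp {inj₂ i} {inj₁ j} r = EqClosure.return (fromL (inj₂ (suc i)) (inj₁ (suc j)) (PW.inj₂ r))
    unfold-resp {inj₂ i} {inj₂ j} r = EqClosure.return (fromL (inj₂ (suc i)) (inj₂ (suc j)) (PW.inj₂ r))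

    mid₀~mid₁ : Cl U (mid zero) (mid (suc zero))
    mid₀~mid₁ = EqClosure.return (fromU (inj₁ zero) (inj₁ (suc zero)) (PW.inj₁ tt))

    unfold∘fold : ∀ a → Cl U a (unfold (fold a))
    unfold∘fold (low zero) = Cl-trans (EqClosure.return (fromL (inj₁ zero) (inj₂ zero) (PW.inj₁ tt))) mid₀~mid₁
    unfold∘fold (low (suc i)) = Cl-refl
    unfold∘fold (mid zero) = mid₀~mid₁
    unfold∘fold (mid (suc j)) = Cl-refl
    unfold∘fold (high j) = Cl-sym (EqClosure.return (fromU (inj₁ (suc (suc j))) (inj₂ j) (PW.inj₂ (idR-diag l j))))

    fold∘outer : ∀ x → fold (outer x) ≡ rotUL-point x
    fold∘outer (inj₁ zero) = refl
    fold∘outer (inj₁ (suc i)) = refl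
    fold∘outer (inj₂ j) = refl

  composite≈rotUL : composite ≈ rotUL lo c u R
  composite≈rotUL = ≈-from-Cl⇔ λ x y → begin
    Cl (Part.R composite) x y                     ≈⟨ Cl-rel-Cl outer x y ⟩
    Cl U (outer x) (outer y)                      ≈⟨ Cl-⇔-quasiInverse fold unfold fold-resp unfold-resp unfold∘fold _ _ ⟩
    Cl R (fold (outer x)) (fold (outer y))        ≡⟨ cong₂ (Cl R) (fold∘outer x) (fold∘outer y) ⟩
    Cl R (rotUL-point x) (rotUL-point y)          ≈⟨ Cl-rel-bijection rotUL-point rotLL-point rotLL-point∘rotUL-point rotUL-point∘rotLL-point x y ⟨
    Cl (rel rotUL-point R) x y                    ≈⟨ Cl-cong (R-rotUL lo c u R) x y ⟨
    Cl (Part.R (rotUL lo c u R)) x y              ∎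
    where open ⇔-Reasoning

-- The partition idP ⊗ ⋯ ⊗ idP ⊗ pairP c (inv c) with upper row u and lower row
-- (u ∷ʳ c) ++ [inv c].
ΓR : (l : ℕ) → Rel (Pt (suc l + 1) l) 0ℓ
ΓR zero _ _ = ⊤
ΓR (suc l) x y = Pointwise (λ _ _ → ⊤) (ΓR l) (side {1} {suc l + 1} {1} {l} x) (side {1} {suc l + 1} {1} {l} y)

Γidx : ∀ {l} → Pt (suc l + 1) l → Fin (suc l)
Γidx {l} (inj₁ z) with splitAt (suc l) {1} z
... | inj₁ j = j
... | inj₂ _ = fromℕ l
Γidx (inj₂ j) = inject₁ j

ΓR⇒Γidx≡ : ∀ l {x y : Pt (suc l + 1) l} → ΓR l x y → Γidx x ≡ Γidx y
ΓR⇒Γidx≡ zero {inj₁ zero} {inj₁ zero} _ = refl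
ΓR⇒Γidx≡ zero {inj₁ zero} {inj₁ (suc zero)} _ = refl
ΓR⇒Γidx≡ zero {inj₁ (suc zero)} {inj₁ zero} _ = refl
ΓR⇒Γidx≡ zero {inj₁ (suc zero)} {inj₁ (suc zero)} _ = refl
ΓR⇒Γidx≡ (suc l) {x} {y} r = trans (Γidx-side x) (trans (sides r) (sym (Γidx-side y)))
  where
  Γidxˢ : Pt 1 1 ⊎ Pt (suc l + 1) l → Fin (suc (suc l))
  Γidxˢ (inj₁ _) = zero
  Γidxˢ (inj₂ z) = suc (Γidx z)
  Γidx-side : ∀ z → Γidx z ≡ Γidxˢ (side {1} {suc l + 1} {1} {l} z)
  Γidx-side (inj₁ zero) = refl
  Γidx-side (inj₁ (suc a)) with splitAt (suc l) {1} a
  ... | inj₁ _ = refl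
  ... | inj₂ _ = refl
  Γidx-side (inj₂ zero) = refl
  Γidx-side (inj₂ (suc b)) = refl
  sides : ∀ {a b} → Pointwise (λ _ _ → ⊤) (ΓR l) a b → Γidxˢ a ≡ Γidxˢ b
  sides (PW.inj₁ _) = refl
  sides (PW.inj₂ r) = cong suc (ΓR⇒Γidx≡ l r)

ΓR-pair : ∀ l → ΓR l (inj₁ (suc l ↑ʳ zero)) (inj₁ (fromℕ l ↑ˡ 1))
ΓR-pair zero = tt
ΓR-pair (suc l) = PW.inj₂ (ΓR-pair l)

ΓR-diag : ∀ l (j : Fin l) → ΓR l (inj₁ (inject₁ j ↑ˡ 1)) (inj₂ j)
ΓR-diag (suc l) zero = PW.inj₁ tt
ΓR-diag (suc l) (suc j) = PW.inj₂ (ΓR-diag l j)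

module RotUR {k l} (lo : Vec Col k) (u : Vec Col l) (c : Col) (R : Rel (Pt k (suc l)) 0ℓ) where

  lower : Part
  lower = mk lo (u ∷ʳ c) R ⊗ idP (inv c)

  composite : Part
  composite = compose (lo ++ inv c ∷ []) ((u ∷ʳ c) ++ inv c ∷ []) u (Part.R lower) (ΓR l)

  -- The composite has lower row lo ++ [inv c] rather than lo ∷ʳ inv c, hence the cast.
  k+1≡ : suc k ≡ k + 1
  k+1≡ = +-comm 1 k

  toComposite : Pt (suc k) l → Pt (k + 1) l
  toComposite (inj₁ i) = inj₁ (cast k+1≡ i)
  toComposite (inj₂ j) = inj₂ j

  private
    U : Rel (MPt (k + 1) (suc l + 1) l) 0ℓ
    U = Union (Part.R lower) (ΓR l)

    fold : MPt (k + 1) (suc l + 1) l → Pt k (suc l)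
    fold (low z) with splitAt k {1} z
    ... | inj₁ i = inj₁ i
    ... | inj₂ _ = inj₂ (fromℕ l)
    fold (mid z) with splitAt (suc l) {1} z
    ... | inj₁ j = inj₂ j
    ... | inj₂ _ = inj₂ (fromℕ l)
    fold (high j) = inj₂ (inject₁ j)

    foldˡ : Pt k (suc l) ⊎ Pt 1 1 → Pt k (suc l)
    foldˡ (inj₁ z) = z
    foldˡ (inj₂ _) = inj₂ (fromℕ l)

    fold-embL : ∀ x → fold (embL x) ≡ foldˡ (side {k} {1} {suc l} {1} x)
    fold-embL (inj₁ z) with splitAt k {1} z
    ... | inj₁ _ = refl
    ... | inj₂ _ = refl
    fold-embL (inj₂ z) with splitAt (suc l) {1} z
    ... | inj₁ _ = refl
    ... | inj₂ _ = refl

    fold-embU : ∀ x → fold (embU x) ≡ inj₂ (Γidx x)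
    fold-embU (inj₁ z) with splitAt (suc l) {1} z
    ... | inj₁ _ = refl
    ... | inj₂ _ = refl
    fold-embU (inj₂ j) = refl

    foldˡ-resp : ∀ {a b} → Pointwise R (λ _ _ → ⊤) a b → Cl R (foldˡ a) (foldˡ b)
    foldˡ-resp (PW.inj₁ r) = EqClosure.return r
    foldˡ-resp (PW.inj₂ _) = Cl-refl

    fold-resp : ∀ {a b} → U a b → Cl R (fold a) (fold b)
    fold-resp (fromL x y r) = subst₂ (Cl R) (sym (fold-embL x)) (sym (fold-embL y)) (foldˡ-resp r)
    fold-resp (fromU x y r) = subst₂ (Cl R) (sym (fold-embU x)) (sym (fold-embU y))
                                (Cl-reflexive (cong inj₂ (ΓR⇒Γidx≡ l r)))

    unfoldPt : Pt k (suc l) → Pt (k + 1) (suc l + 1)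
    unfoldPt (inj₁ i) = inj₁ (i ↑ˡ 1)
    unfoldPt (inj₂ j) = inj₂ (j ↑ˡ 1)

    side-unfoldPt : ∀ x → side {k} {1} {suc l} {1} (unfoldPt x) ≡ inj₁ x
    side-unfoldPt (inj₁ i) rewrite splitAt-↑ˡ k i 1 = refl
    side-unfoldPt (inj₂ j) rewrite splitAt-↑ˡ (suc l) j 1 = refl

    unfold : Pt k (suc l) → MPt (k + 1) (suc l + 1) l
    unfold = embL ∘ unfoldPt

    unfold-resp : ∀ {x y} → R x y → Cl U (unfold x) (unfold y)
    unfold-resp {x} {y} r = EqClosure.return (fromL (unfoldPt x) (unfoldPt y)
      (subst₂ (Pointwise R (λ _ _ → ⊤)) (sym (side-unfoldPt x)) (sym (side-unfoldPt y)) (PW.inj₁ r)))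

    pair : Cl U (mid (suc l ↑ʳ zero)) (mid (fromℕ l ↑ˡ 1))
    pair = EqClosure.return (fromU (inj₁ (suc l ↑ʳ zero)) (inj₁ (fromℕ l ↑ˡ 1)) (ΓR-pair l))

    new-lower : ∀ z → splitAt k {1} z ≡ inj₂ zero → Cl U (low z) (mid (suc l ↑ʳ zero))
    new-lower z e = EqClosure.return (fromL (inj₁ z) (inj₂ (suc l ↑ʳ zero))
      (subst₂ (Pointwise R (λ _ _ → ⊤)) (sym (side-new e)) (sym side-last) (PW.inj₂ tt)))
      where
      side-new : splitAt k {1} z ≡ inj₂ zero → side {k} {1} {suc l} {1} (inj₁ z) ≡ inj₂ (inj₁ zero)
      side-new e′ with splitAt k {1} z | e′
      ... | _ | refl = refl
      side-last : side {k} {1} {suc l} {1} (inj₂ (suc l ↑ʳ zero)) ≡ inj₂ (inj₂ zero)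
      side-last rewrite splitAt-↑ʳ (suc l) 1 zero = refl

    unfold∘fold : ∀ a → Cl U a (unfold (fold a))
    unfold∘fold (low z) with splitAt k {1} z in e
    ... | inj₁ i = Cl-reflexive (cong low (sym (splitAt⁻¹-↑ˡ e)))
    ... | inj₂ zero = Cl-trans (new-lower z e) pair
    unfold∘fold (mid z) with splitAt (suc l) {1} z in e
    ... | inj₁ j = Cl-reflexive (cong mid (sym (splitAt⁻¹-↑ˡ e)))
    ... | inj₂ zero = subst (λ w → Cl U (mid w) (mid (fromℕ l ↑ˡ 1))) (splitAt⁻¹-↑ʳ e) pair
    unfold∘fold (high j) = Cl-sym (EqClosure.return (fromU (inj₁ (inject₁ j ↑ˡ 1)) (inj₂ j) (ΓR-diag l j)))

    pos-fold-low : ∀ z → pos (fold (low z)) ≡ toℕ z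
    pos-fold-low z with splitAt k {1} z in e
    ... | inj₁ a = trans (sym (toℕ-↑ˡ a 1)) (cong toℕ (splitAt⁻¹-↑ˡ e))
    ... | inj₂ zero = trans (pos-fromℕ-upper {k} {l}) (trans (toℕ-fromℕ k)
                        (trans (sym (+-identityʳ k)) (trans (sym (toℕ-↑ʳ k (zero {0}))) (cong toℕ (splitAt⁻¹-↑ʳ e)))))

    fold∘outer : ∀ x → fold (outer (toComposite x)) ≡ rotUR-point x
    fold∘outer (inj₁ i) = pos-injective (trans (pos-fold-low (cast k+1≡ i))
                            (trans (toℕ-cast k+1≡ i) (sym (pos-rotUR-point (inj₁ i)))))
    fold∘outer (inj₂ j) = refl

    rotLR-point∘rotUR-point : ∀ (x : Pt (suc k) l) → rotLR-point (rotUR-point x) ≡ x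
    rotLR-point∘rotUR-point x = pos-injective (trans (pos-rotLR-point (rotUR-point x)) (pos-rotUR-point x))

    rotUR-point∘rotLR-point : ∀ (x : Pt k (suc l)) → rotUR-point (rotLR-point x) ≡ x
    rotUR-point∘rotLR-point x = pos-injective (trans (pos-rotUR-point (rotLR-point x)) (pos-rotLR-point x))

  pos-toComposite : ∀ x → pos (toComposite x) ≡ pos x
  pos-toComposite (inj₁ i) = toℕ-cast k+1≡ i
  pos-toComposite (inj₂ j) = cong (_+ (l ∸ suc (toℕ j))) (sym k+1≡)

  ncol-toComposite : ∀ x → ncol (rotUR lo u c R) x ≡ ncol composite (toComposite x)
  ncol-toComposite (inj₁ i) = sym (trans (cong (λ v → lookup v (cast k+1≡ i)) (sym (unfold-∷ʳ-eqFree (inv c) lo)))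
                                         (lookup-cast k+1≡ (lo ∷ʳ inv c) i))
  ncol-toComposite (inj₂ j) = refl

  blocks-toComposite : ∀ x y → Cl (Part.R (rotUR lo u c R)) x y ⇔ Cl (Part.R composite) (toComposite x) (toComposite y)
  blocks-toComposite x y = begin
    Cl (Part.R (rotUR lo u c R)) x y                ≈⟨ Cl-cong (R-rotUR lo u c R) x y ⟩
    Cl (rel rotUR-point R) x y                      ≈⟨ Cl-rel-bijection rotUR-point rotLR-point rotLR-point∘rotUR-point rotUR-point∘rotLR-point x y ⟩
    Cl R (rotUR-point x) (rotUR-point y)            ≡⟨ cong₂ (Cl R) (fold∘outer x) (fold∘outer y) ⟨
    Cl R (fold (outer (toComposite x))) (fold (outer (toComposite y)))
      ≈⟨ Cl-⇔-quasiInverse fold unfold fold-resp unfold-resp unfold∘fold _ _ ⟨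
    Cl U (outer (toComposite x)) (outer (toComposite y))
      ≈⟨ Cl-rel-Cl outer _ _ ⟨
    Cl (Part.R composite) (toComposite x) (toComposite y) ∎
    where open ⇔-Reasoning

module FromCategory (C : Part → Set) (C-resp-≈ : IsSetOfPartitions C) (category : IsCategory C) where

  C-∅ : C ∅
  C-∅ = proj₁ category
  C-idP-white : C (idP white)
  C-idP-white = proj₁ (proj₂ category)
  C-idP-black : C (idP black)
  C-idP-black = proj₁ (proj₂ (proj₂ category))
  C-pairP-black-white : C (pairP black white)
  C-pairP-black-white = proj₁ (proj₂ (proj₂ (proj₂ category)))
  C-pairP-white-black : C (pairP white black)
  C-pairP-white-black = proj₁ (proj₂ (proj₂ (proj₂ (proj₂ category))))
  tensor-closed : ClosedTensor C
  tensor-closed = proj₁ (proj₂ (proj₂ (proj₂ (proj₂ (proj₂ category)))))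
  involution-closed : ClosedInvolution C
  involution-closed = proj₁ (proj₂ (proj₂ (proj₂ (proj₂ (proj₂ (proj₂ category))))))
  composition-closed : ClosedComposition C
  composition-closed = proj₂ (proj₂ (proj₂ (proj₂ (proj₂ (proj₂ (proj₂ category))))))

  C-idP : ∀ c → C (idP c)
  C-idP white = C-idP-white
  C-idP black = C-idP-black

  C-pairP : ∀ c d → c ≢ d → C (pairP c d)
  C-pairP white white c≢d = ⊥-elim (c≢d refl)
  C-pairP white black _ = C-pairP-white-black
  C-pairP black white _ = C-pairP-black-white
  C-pairP black black c≢d = ⊥-elim (c≢d refl)

  inv-≢ : ∀ c → inv c ≢ c
  inv-≢ white ()
  inv-≢ black ()

  C-identity : ∀ {m} (w : Vec Col m) → C (mk w w (idR m))
  C-identity [] = C-∅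
  C-identity (c ∷ w) = tensor-closed _ _ (C-idP c) (C-identity w)

  C-Γ : ∀ {l} (u : Vec Col l) c → C (mk ((u ∷ʳ c) ++ inv c ∷ []) u (ΓR l))
  C-Γ [] c = C-pairP c (inv c) (inv-≢ c ∘ sym)
  C-Γ (d ∷ u) c = tensor-closed _ _ (C-idP d) (C-Γ u c)

  rotUL-closed : ∀ {k l} (lo : Vec Col k) c (u : Vec Col l) R → C (mk lo (c ∷ u) R) → C (rotUL lo c u R)
  rotUL-closed lo c u R Cp = C-resp-≈ composite≈rotUL (composition-closed _ _ _ _ _
    (tensor-closed _ _ (C-idP (inv c)) Cp) (tensor-closed _ _ (C-pairP (inv c) c (inv-≢ c)) (C-identity u)))
    where open RotUL lo c u R

  rotUR-closed : ∀ {k l} (lo : Vec Col k) (u : Vec Col l) c R → C (mk lo (u ∷ʳ c) R) → C (rotUR lo u c R)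
  rotUR-closed lo u c R Cp = relabel C C-resp-≈ k+1≡ refl toComposite pos-toComposite ncol-toComposite
    blocks-toComposite (composition-closed _ _ _ _ _ (tensor-closed _ _ Cp (C-idP (inv c))) (C-Γ u c))
    where open RotUR lo u c R

  rotLL-closed : ∀ {k l} c (lo : Vec Col k) (u : Vec Col l) R → C (mk (c ∷ lo) u R) → C (rotLL c lo u R)
  rotLL-closed c lo u R Cp = C-resp-≈ (≈-from-Cl⇔ (Cl-cong R-swap))
    (involution-closed _ (rotUL-closed u c lo _ (involution-closed _ Cp)))
    where
    R-swap : ∀ x y → Part.R (rotUL u c lo (rel swapPt R) *) x y ⇔ Part.R (rotLL c lo u R) x y
    R-swap (inj₁ i) (inj₁ j) = ⇔-id _
    R-swap (inj₁ i) (inj₂ zero) = ⇔-id _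
    R-swap (inj₁ i) (inj₂ (suc j)) = ⇔-id _
    R-swap (inj₂ zero) (inj₁ j) = ⇔-id _
    R-swap (inj₂ zero) (inj₂ zero) = ⇔-id _
    R-swap (inj₂ zero) (inj₂ (suc j)) = ⇔-id _
    R-swap (inj₂ (suc i)) (inj₁ j) = ⇔-id _
    R-swap (inj₂ (suc i)) (inj₂ zero) = ⇔-id _
    R-swap (inj₂ (suc i)) (inj₂ (suc j)) = ⇔-id _

  rotLR-closed : ∀ {k l} (lo : Vec Col k) c (u : Vec Col l) R → C (mk (lo ∷ʳ c) u R) → C (rotLR lo c u R)
  rotLR-closed {l = l} lo c u R Cp = C-resp-≈ (≈-from-Cl⇔ (Cl-cong R-swap))
    (involution-closed _ (rotUR-closed u lo c _ (involution-closed _ Cp)))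
    where
    R-swap : ∀ x y → Part.R (rotUR u lo c (rel swapPt R) *) x y ⇔ Part.R (rotLR lo c u R) x y
    R-swap (inj₁ i) (inj₁ j) = ⇔-id _
    R-swap (inj₁ i) (inj₂ j) with snocView {l} j
    ... | inj₁ _ = ⇔-id _
    ... | inj₂ _ = ⇔-id _
    R-swap (inj₂ i) (inj₁ j) with snocView {l} i
    ... | inj₁ _ = ⇔-id _
    ... | inj₂ _ = ⇔-id _
    R-swap (inj₂ i) (inj₂ j) with snocView {l} i | snocView {l} j
    ... | inj₁ _ | inj₁ _ = ⇔-id _
    ... | inj₁ _ | inj₂ _ = ⇔-id _
    ... | inj₂ _ | inj₁ _ = ⇔-id _
    ... | inj₂ _ | inj₂ _ = ⇔-id _

  rotations-closed : ClosedRotations C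
  rotations-closed = rotUL-closed , rotUR-closed , rotLL-closed , rotLR-closed

module CapFirstTwo {m} (c₀ c₁ : Col) (w : Vec Col m) (Q : Rel (Pt (suc (suc m)) 0) 0ℓ) where

  cap : Part
  cap = ((pairP c₀ c₁) *) ⊗ mk w w (idR m)

  capped : Part
  capped = compose w (c₀ ∷ c₁ ∷ w) [] (Part.R cap) Q

  skip2 : Pt m 0 → Pt (suc (suc m)) 0
  skip2 (inj₁ i) = inj₁ (suc (suc i))

  open Merge Q (inj₁ zero) (inj₁ (suc zero)) using (Merged; WithEdge; old; new; Cl-WithEdge)

  private
    U : Rel (MPt m (suc (suc m)) 0) 0ℓ
    U = Union (Part.R cap) Q

    fold : MPt m (suc (suc m)) 0 → Pt (suc (suc m)) 0
    fold (low i) = inj₁ (suc (suc i))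
    fold (mid j) = inj₁ j

    foldˢ : Pt 0 2 ⊎ Pt m m → Pt (suc (suc m)) 0
    foldˢ (inj₁ (inj₂ j)) = inj₁ (j ↑ˡ m)
    foldˢ (inj₂ z) = inj₁ (suc (suc (idx z)))

    fold-embL : ∀ x → fold (embL x) ≡ foldˢ (side {0} {m} {2} {m} x)
    fold-embL (inj₁ i) = refl
    fold-embL (inj₂ zero) = refl
    fold-embL (inj₂ (suc zero)) = refl
    fold-embL (inj₂ (suc (suc j))) = refl

    pair-resp : ∀ i j → Cl WithEdge (inj₁ (i ↑ˡ m)) (inj₁ (j ↑ˡ m))
    pair-resp zero zero = Cl-refl
    pair-resp zero (suc zero) = EqClosure.return new
    pair-resp (suc zero) zero = Cl-sym (EqClosure.return new)
    pair-resp (suc zero) (suc zero) = Cl-refl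

    foldˢ-resp : ∀ {a b} → Pointwise (λ _ _ → ⊤) (idR m) a b → Cl WithEdge (foldˢ a) (foldˢ b)
    foldˢ-resp {inj₁ (inj₂ i)} {inj₁ (inj₂ j)} (PW.inj₁ _) = pair-resp i j
    foldˢ-resp (PW.inj₂ r) = Cl-reflexive (cong (λ i → inj₁ (suc (suc i))) (idR⇒idx≡ m r))

    fold-resp : ∀ {a b} → U a b → Cl WithEdge (fold a) (fold b)
    fold-resp (fromL x y r) = subst₂ (Cl WithEdge) (sym (fold-embL x)) (sym (fold-embL y)) (foldˢ-resp r)
    fold-resp (fromU (inj₁ i) (inj₁ j) r) = EqClosure.return (old r)

    unfold : Pt (suc (suc m)) 0 → MPt m (suc (suc m)) 0
    unfold (inj₁ j) = mid j

    unfold-resp : ∀ {x y} → WithEdge x y → Cl U (unfold x) (unfold y)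
    unfold-resp (old {inj₁ i} {inj₁ j} r) = EqClosure.return (fromU (inj₁ i) (inj₁ j) r)
    unfold-resp new = EqClosure.return (fromL (inj₂ zero) (inj₂ (suc zero)) (PW.inj₁ tt))

    unfold∘fold : ∀ a → Cl U a (unfold (fold a))
    unfold∘fold (low i) = EqClosure.return (fromL (inj₁ i) (inj₂ (suc (suc i))) (PW.inj₂ (idR-diag m i)))
    unfold∘fold (mid j) = Cl-refl

    fold∘outer : ∀ x → fold (outer x) ≡ skip2 x
    fold∘outer (inj₁ i) = refl

  blocks-capped : ∀ x y → Cl (Part.R capped) x y ⇔ Merged (skip2 x) (skip2 y)
  blocks-capped x y = begin
    Cl (Part.R capped) x y                        ≈⟨ Cl-rel-Cl outer x y ⟩
    Cl U (outer x) (outer y)                      ≈⟨ Cl-⇔-quasiInverse fold unfold fold-resp unfold-resp unfold∘fold _ _ ⟩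
    Cl WithEdge (fold (outer x)) (fold (outer y)) ≡⟨ cong₂ (Cl WithEdge) (fold∘outer x) (fold∘outer y) ⟩
    Cl WithEdge (skip2 x) (skip2 y)               ≈⟨ Cl-WithEdge _ _ ⟩
    Merged (skip2 x) (skip2 y)                    ∎
    where open ⇔-Reasoning

module TurnArithmetic (m : ℕ) .{{_ : NonZero m}} where

  private
    n : ℕ
    n = suc (suc m)

  [2+[x+[m∸a]]%m+a]%n≡x : ∀ {a x} → a ≤ m → x < a → (2 + (x + (m ∸ a)) % m + a) % n ≡ x
  [2+[x+[m∸a]]%m+a]%n≡x {a} {x} a≤m x<a = begin
    (2 + (x + (m ∸ a)) % m + a) % n   ≡⟨ cong (λ r → (2 + r + a) % n) (m<n⇒m%n≡m x+[m∸a]<m) ⟩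
    (2 + (x + (m ∸ a)) + a) % n       ≡⟨ cong (_% n) 2+[x+[m∸a]]+a≡x+n ⟩
    (x + n) % n                       ≡⟨ [m+n]%n≡m%n x n ⟩
    x % n                             ≡⟨ m<n⇒m%n≡m (<-trans (<-≤-trans x<a a≤m) (m<n+m m z<s)) ⟩
    x                                 ∎
    where
    open ≡-Reasoning
    x+[m∸a]<m : x + (m ∸ a) < m
    x+[m∸a]<m = subst (x + (m ∸ a) <_) (trans (+-comm a (m ∸ a)) (m∸n+n≡m a≤m)) (+-monoˡ-< (m ∸ a) x<a)
    2+[x+[m∸a]]+a≡x+n : 2 + (x + (m ∸ a)) + a ≡ x + n
    2+[x+[m∸a]]+a≡x+n = begin
      2 + (x + (m ∸ a)) + a     ≡⟨ cong (_+ a) (+-comm 2 (x + (m ∸ a))) ⟩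
      x + (m ∸ a) + 2 + a       ≡⟨ +-assoc (x + (m ∸ a)) 2 a ⟩
      x + (m ∸ a) + (2 + a)     ≡⟨ +-assoc x (m ∸ a) (2 + a) ⟩
      x + ((m ∸ a) + (2 + a))   ≡⟨ cong (x +_) (+-comm (m ∸ a) (2 + a)) ⟩
      x + (2 + a + (m ∸ a))     ≡⟨ cong (x +_) (+-assoc 2 a (m ∸ a)) ⟩
      x + (2 + (a + (m ∸ a)))   ≡⟨ cong (λ r → x + (2 + r)) (m+[n∸m]≡n a≤m) ⟩
      x + n                     ∎

  [2+[x+[m∸a]]%m+a]%n≡2+x : ∀ {a x} → a ≤ m → a ≤ x → x < m → (2 + (x + (m ∸ a)) % m + a) % n ≡ 2 + x
  [2+[x+[m∸a]]%m+a]%n≡2+x {a} {x} a≤m a≤x x<m = begin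
    (2 + (x + (m ∸ a)) % m + a) % n   ≡⟨ cong (λ r → (2 + r % m + a) % n) x+[m∸a]≡[x∸a]+m ⟩
    (2 + ((x ∸ a) + m) % m + a) % n   ≡⟨ cong (λ r → (2 + r + a) % n) ([m+n]%n≡m%n (x ∸ a) m) ⟩
    (2 + (x ∸ a) % m + a) % n         ≡⟨ cong (λ r → (2 + r + a) % n) (m<n⇒m%n≡m (≤-<-trans (m∸n≤m x a) x<m)) ⟩
    (2 + (x ∸ a) + a) % n             ≡⟨ cong (λ r → (2 + r) % n) (m∸n+n≡m a≤x) ⟩
    (2 + x) % n                       ≡⟨ m<n⇒m%n≡m (s≤s (s≤s x<m)) ⟩
    2 + x                             ∎
    where
    open ≡-Reasoning
    x+[m∸a]≡[x∸a]+m : x + (m ∸ a) ≡ (x ∸ a) + m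
    x+[m∸a]≡[x∸a]+m = begin
      x + (m ∸ a)             ≡⟨ cong (_+ (m ∸ a)) (m∸n+n≡m a≤x) ⟨
      (x ∸ a) + a + (m ∸ a)   ≡⟨ +-assoc (x ∸ a) a (m ∸ a) ⟩
      (x ∸ a) + (a + (m ∸ a)) ≡⟨ cong ((x ∸ a) +_) (m+[n∸m]≡n a≤m) ⟩
      (x ∸ a) + m             ∎

  [2+[x+[m∸[1+m]]]%m+1+m]%n≡1+x : ∀ {x} → x < m → (2 + (x + (m ∸ suc m)) % m + suc m) % n ≡ suc x
  [2+[x+[m∸[1+m]]]%m+1+m]%n≡1+x {x} x<m = begin
    (2 + (x + (m ∸ suc m)) % m + suc m) % n   ≡⟨ cong (λ r → (2 + (x + r) % m + suc m) % n) (m≤n⇒m∸n≡0 (n≤1+n m)) ⟩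
    (2 + (x + 0) % m + suc m) % n             ≡⟨ cong (λ r → (2 + r + suc m) % n) (trans (cong (_% m) (+-identityʳ x)) (m<n⇒m%n≡m x<m)) ⟩
    (2 + x + suc m) % n                       ≡⟨ cong (λ r → suc r % n) (sym (+-suc x (suc m))) ⟩
    (suc x + n) % n                           ≡⟨ [m+n]%n≡m%n (suc x) n ⟩
    suc x % n                                 ≡⟨ m<n⇒m%n≡m (s≤s (<-trans x<m (n<1+n m))) ⟩
    suc x                                     ∎
    where open ≡-Reasoning

-- Rotate p by a = pos α so that the turn becomes the first two lower points of q, cap
-- them, and rotate back by m ∸ a; when α is the last point (a = 1 + m) the truncated
-- subtraction makes this the shift by 0 that the wrap-around case needs.
module EraseTurn (C : Part → Set) (C-resp-≈ : IsSetOfPartitions C) (category : IsCategory C)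
                 {k l} (lo : Vec Col k) (u : Vec Col l) (R : Rel (Pt k l) 0ℓ) (α β : Pt k l)
                 (turn : Turn (mk lo u R) α β) (Cp : C (mk lo u R)) where

  open FromCategory C C-resp-≈ category
  open Erase lo u R α β (proj₁ (proj₂ turn))

  private
    p : Part
    p = mk lo u R

  module NonEmpty (m′ : ℕ) (size-erased : size erased ≡ suc m′) where

    private
      m n a : ℕ
      m = suc m′
      n = suc (suc m)
      a = pos α

      module Sₙ = CyclicShift n
      module Sₘ = CyclicShift m

      size-p : k + l ≡ n
      size-p = trans (sym size-erase) (cong (λ r → suc (suc r)) size-erased)

      toP : Pt n 0 → Pt k l
      toP x = Sₙ.pointAt% {k} {l} size-p (pos x + a)

      colours : Fin n → Col
      colours i = ncol p (toP (inj₁ i))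

      c₀ c₁ : Col
      c₀ = colours zero
      c₁ = colours (suc zero)

      w : Vec Col m
      w = tabulate (λ i → colours (suc (suc i)))

      q : Part
      q = mk (c₀ ∷ c₁ ∷ w) [] (rel toP R)

      ncol-toP : ∀ x → ncol q x ≡ ncol p (toP x)
      ncol-toP (inj₁ zero) = refl
      ncol-toP (inj₁ (suc zero)) = refl
      ncol-toP (inj₁ (suc (suc i))) = lookup∘tabulate (λ i → colours (suc (suc i))) i

      q→p : Sₙ.Shift q p a
      q→p = Sₙ.shift-fromRel a toP (+-identityʳ n) size-p (λ x → Sₙ.pos-pointAt% {k} {l} size-p (pos x + a))
              ncol-toP (λ _ _ → ⇔-id _)

      toP-α : toP (inj₁ zero) ≡ α
      toP-α = pos-injective (trans (Sₙ.pos-pointAt% {k} {l} size-p a) (m<n⇒m%n≡m (Sₙ.pos<n size-p α)))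

      toP-β : toP (inj₁ (suc zero)) ≡ β
      toP-β with proj₁ turn
      ... | inj₁ 1+α≡β = pos-injective (trans (Sₙ.pos-pointAt% {k} {l} size-p (suc a))
                           (trans (cong (_% n) 1+α≡β) (m<n⇒m%n≡m (Sₙ.pos<n size-p β))))
      ... | inj₂ (1+α≡size , β≡0) = pos-injective (trans (Sₙ.pos-pointAt% {k} {l} size-p (suc a))
                                      (trans (cong (_% n) (trans 1+α≡size size-p)) (trans (n%n≡0 n) (sym β≡0))))

      c₀≢c₁ : c₀ ≢ c₁
      c₀≢c₁ c₀≡c₁ = proj₂ (proj₂ turn) (trans (cong (ncol p) (sym toP-α)) (trans c₀≡c₁ (cong (ncol p) toP-β)))

    open CapFirstTwo c₀ c₁ w (rel toP R)

    private
      C-capped : C capped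
      C-capped = composition-closed _ _ _ _ _
        (tensor-closed _ _ (involution-closed _ (C-pairP c₀ c₁ c₀≢c₁)) (C-identity w))
        (Sₙ.shift-closed C C-resp-≈ rotations-closed q→p Cp)

      toCapped : Point erased → Pt m 0
      toCapped x = Sₘ.pointAt% {m} {0} (+-identityʳ m) (pos x + (m ∸ a))

      adjacent⇒a≤m : suc a ≡ pos β → a ≤ m
      adjacent⇒a≤m 1+α≡β = ≤-pred (≤-pred (subst (_< n) (sym 1+α≡β) (Sₙ.pos<n size-p β)))

      pos-erase-point : ∀ x → pos (erase-point x) ≡ (2 + (pos x + (m ∸ a)) % m + a) % n
      pos-erase-point x with proj₁ turn
      ... | inj₁ 1+α≡β with pos-erase-point-adjacent 1+α≡β x
      ...   | inj₁ (x<α , e) = trans e (sym (TurnArithmetic.[2+[x+[m∸a]]%m+a]%n≡x m (adjacent⇒a≤m 1+α≡β) x<α))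
      ...   | inj₂ (α≤x , e) = trans e (sym (TurnArithmetic.[2+[x+[m∸a]]%m+a]%n≡2+x m (adjacent⇒a≤m 1+α≡β) α≤x
                                                (Sₘ.pos<n size-erased x)))
      pos-erase-point x | inj₂ (1+α≡size , β≡0) rewrite suc-injective (trans 1+α≡size size-p) =
        trans (pos-erase-point-wrap 1+α≡size β≡0 x)
              (sym (TurnArithmetic.[2+[x+[m∸[1+m]]]%m+1+m]%n≡1+x m (Sₘ.pos<n size-erased x)))

      pos-skip2 : ∀ y → pos (skip2 y) ≡ 2 + pos y
      pos-skip2 (inj₁ i) = refl

      erase-point≡ : ∀ x → erase-point x ≡ toP (skip2 (toCapped x))
      erase-point≡ x = pos-injective (begin
        pos (erase-point x)                           ≡⟨ pos-erase-point x ⟩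
        (2 + (pos x + (m ∸ a)) % m + a) % n           ≡⟨ cong (λ r → (2 + r + a) % n) (Sₘ.pos-pointAt% {m} {0} (+-identityʳ m) (pos x + (m ∸ a))) ⟨
        (2 + pos (toCapped x) + a) % n                ≡⟨ cong (λ r → (r + a) % n) (pos-skip2 (toCapped x)) ⟨
        (pos (skip2 (toCapped x)) + a) % n            ≡⟨ Sₙ.pos-pointAt% {k} {l} size-p (pos (skip2 (toCapped x)) + a) ⟨
        pos (toP (skip2 (toCapped x)))                ∎)
        where open ≡-Reasoning

      ncol-skip2 : ∀ y → ncol q (skip2 y) ≡ ncol capped y
      ncol-skip2 (inj₁ i) = refl

      blocks-toCapped : ∀ x y → Cl (Part.R erased) x y ⇔ Cl (Part.R capped) (toCapped x) (toCapped y)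
      blocks-toCapped x y = begin
        Cl (Part.R erased) x y
          ≈⟨ blocks-erase x y ⟩
        Merged (erase-point x) (erase-point y)
          ≡⟨ cong₂ Merged (erase-point≡ x) (erase-point≡ y) ⟩
        Merged (toP (skip2 (toCapped x))) (toP (skip2 (toCapped y)))
          ≡⟨ cong₂ (λ γ δ → Merge.Merged R γ δ (toP (skip2 (toCapped x))) (toP (skip2 (toCapped y)))) toP-α toP-β ⟨
        Merge.Merged R (toP (inj₁ zero)) (toP (inj₁ (suc zero))) (toP (skip2 (toCapped x))) (toP (skip2 (toCapped y)))
          ≈⟨ Merged-transport toP (Sₙ.Shift.blocks-point q→p) (inj₁ zero) (inj₁ (suc zero)) _ _ ⟨
        Merge.Merged (rel toP R) (inj₁ zero) (inj₁ (suc zero)) (skip2 (toCapped x)) (skip2 (toCapped y))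
          ≈⟨ blocks-capped (toCapped x) (toCapped y) ⟨
        Cl (Part.R capped) (toCapped x) (toCapped y)
          ∎
        where open ⇔-Reasoning

      erased→capped : Sₘ.Shift erased capped (m ∸ a)
      erased→capped = record
        { size-t = size-erased ; size-p = +-identityʳ m ; point = toCapped
        ; pos-point = λ x → Sₘ.pos-pointAt% {m} {0} (+-identityʳ m) (pos x + (m ∸ a))
        ; ncol-point = λ x → trans (ncol-erase x) (trans (cong (ncol p) (erase-point≡ x))
                               (trans (sym (ncol-toP (skip2 (toCapped x)))) (ncol-skip2 (toCapped x))))
        ; blocks-point = blocks-toCapped }

    C-erased : C erased
    C-erased = Sₘ.shift-closed C C-resp-≈ rotations-closed erased→capped C-capped

  C-erased : C erased
  C-erased with size erased in e
  ... | zero = empty-closed C C-resp-≈ e refl C-∅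
  ... | suc m′ = NonEmpty.C-erased m′ e

lemma4p3 : (C : Part → Set) → IsSetOfPartitions C →
    (IsCategory C → C (idP white) × ClosedTensor C × ClosedRotations C × ClosedVerticolor C × ClosedErasingTurns C)
    × (C (idP white) × ClosedTensor C × ClosedRotations C × ClosedVerticolor C × ClosedErasingTurns C → IsCategory C)
lemma4p3 C C-resp-≈ = category⇒closures , closures⇒category
  where
  category⇒closures : IsCategory C →
    C (idP white) × ClosedTensor C × ClosedRotations C × ClosedVerticolor C × ClosedErasingTurns C
  category⇒closures category =
    C-idP-white , tensor-closed , rotations-closed ,
    rotations+involution⇒verticolor C C-resp-≈ rotations-closed involution-closed ,
    λ p α β turn → EraseTurn.C-erased C C-resp-≈ category (lo p) (up p) (R p) α β turn
    where open FromCategory C C-resp-≈ category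

  closures⇒category :
    C (idP white) × ClosedTensor C × ClosedRotations C × ClosedVerticolor C × ClosedErasingTurns C → IsCategory C
  closures⇒category (C-idP-white , tensor , rotations@(rUL , rUR , rLL , _) , vreflect , erase-turn) =
    C-∅ , C-idP-white , C-idP-black , C-pairP-black-white , C-pairP-white-black ,
    tensor , rotations+verticolor⇒involution C C-resp-≈ rotations vreflect ,
    erasing⇒composition C C-resp-≈ tensor rotations erase-turn
    where
    C-∅ : C ∅
    C-∅ = empty-closed C C-resp-≈ refl refl
      (erase-turn (idP white) (inj₁ zero) (inj₂ zero) (inj₁ refl , (λ ()) , (λ ())) C-idP-white)
    C-pairP-white-black : C (pairP white black)
    C-pairP-white-black = rUR (white ∷ []) [] white _ C-idP-white
    C-pairP-black-white : C (pairP black white)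
    C-pairP-black-white = rUL (white ∷ []) white [] _ C-idP-white
    C-idP-black : C (idP black)
    C-idP-black = rLL white (black ∷ []) [] _ C-pairP-white-black
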